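{- Let $R=\{(1,2),(1,3),(2,1),(2,2),(2,3),(3,1),(3,2),(3,3)\}$. Then $(123,R)\sim_d(132,R)$.
   Context: $S_n$ denotes the set of permutations of $[n]=\{1,\dots,n\}$, written $\pi=\pi_1\cdots\pi_n$. A mesh pattern of length $k$ is a pair $(\tau,R)$ with $\tau\in S_k$ and $R\subseteq\{0,1,\dots,k\}^2$ (the shaded boxes; box $(a,b)$ is the unit square $[a,a+1]\times[b,b+1]$ in the diagram of $\tau$). An occurrence of $(\tau,R)$ in $\pi\in S_n$ is a choice of indices $i_1<\dots<i_k$ such that $\pi_{i_1}\cdots\pi_{i_k}$ is order-isomorphic to $\tau$ and, with $i_0=0$, $i_{k+1}=n+1$, $v_1<\dots<v_k$ the values $\pi_{i_1},\dots,\pi_{i_k}$ sorted increasingly, $v_0=0$, $v_{k+1}=n+1$, for every $(a,b)\in R$ there is no index $m$ with $i_a<m<i_{a+1}$ and $v_b<\pi_m<v_{b+1}$. Mesh patterns $p,q$ are equidistributed, $p\sim_d q$, if for all $n,\ell\ge0$ the number of $\pi\in S_n$ with exactly $\ell$ occurrences of $p$ equals the number with exactly $\ell$ occurrences of $q$. -}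

module Defs where

open import Data.Bool using (Bool; true; false; _∧_; _∨_; not; if_then_else_)
open import Data.Nat using (ℕ; zero; suc; _+_; _<ᵇ_; _≡ᵇ_)
open import Data.Fin using (Fin; toℕ)
open import Data.Product using (_×_; _,_)
open import Data.List.Base using (List; []; _∷_; _++_; [_]; map; filterᵇ; length; foldr; upTo; allFin; concatMap)
open import Data.Vec using (Vec; lookup; toList)
import Data.Vec as V
open import Relation.Nullary.Decidable using (does)
open import Relation.Binary.PropositionalEquality using (_≡_)

all : {A : Set} → (A → Bool) → List A → Bool
all p xs = foldr (λ x r → p x ∧ r) true xs

-- A permutation π = π₁⋯πₙ of [n] is stored as a vector of length n whose
-- i-th entry (0-based, as an element of Fin n) is πᵢ - 1.

allVecs : (n k : ℕ) → List (Vec (Fin n) k)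
allVecs n zero    = V.[] ∷ []
allVecs n (suc k) = concatMap (λ x → map (x V.∷_) (allVecs n k)) (allFin n)

finEqᵇ : ∀ {n} → Fin n → Fin n → Bool
finEqᵇ i j = toℕ i ≡ᵇ toℕ j

isPermᵇ : ∀ {n} → Vec (Fin n) n → Bool
isPermᵇ {n} π =
  all (λ i → all (λ j → not (finEqᵇ (lookup π i) (lookup π j)) ∨ finEqᵇ i j)
                 (allFin n))
      (allFin n)

S : (n : ℕ) → List (Vec (Fin n) n)
S n = filterᵇ isPermᵇ (allVecs n n)

word : ∀ {n} → Vec (Fin n) n → List ℕ
word π = map (λ x → suc (toℕ x)) (toList π)

-- A mesh pattern (τ , R): τ = τ₁⋯τₖ in one-line notation (values 1..k),
-- R a list of shaded boxes (a , b) with 0 ≤ a , b ≤ k.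
record MeshPattern : Set where
  constructor mesh
  field
    τ : List ℕ
    R : List (ℕ × ℕ)
open MeshPattern public

insert : ℕ → List ℕ → List ℕ
insert x []       = x ∷ []
insert x (y ∷ ys) = if x <ᵇ y then x ∷ y ∷ ys else y ∷ insert x ys

sort : List ℕ → List ℕ
sort []       = []
sort (x ∷ xs) = insert x (sort xs)

-- 0-based lookup with default 0
at : List ℕ → ℕ → ℕ
at []       _       = 0
at (x ∷ xs) zero    = x
at (x ∷ xs) (suc i) = at xs i

-- 1-based: the i-th letter of a word
letter : List ℕ → ℕ → ℕ
letter w zero    = 0
letter w (suc i) = at w i

choose : ℕ → List ℕ → List (List ℕ)
choose zero    xs       = [] ∷ []
choose (suc k) []       = []
choose (suc k) (x ∷ xs) = map (x ∷_) (choose k xs) ++ choose (suc k) xs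

positions : ℕ → List ℕ
positions n = map suc (upTo n)

orderIsoᵇ : List ℕ → List ℕ → Bool
orderIsoᵇ u t =
  all (λ a → all (λ b → does ((at u a <ᵇ at u b) Data.Bool.≟ (at t a <ᵇ at t b)))
                 (upTo (length t)))
      (upTo (length t))
  ∧ (length u ≡ᵇ length t)

-- With I = i₀ i₁ ⋯ iₖ iₖ₊₁ (i₀ = 0, iₖ₊₁ = n+1) and
-- V = v₀ v₁ ⋯ vₖ vₖ₊₁ (v₀ = 0, v₁<⋯<vₖ the sorted values, vₖ₊₁ = n+1),
-- every shaded box (a , b) ∈ R must contain no point (m , πₘ) with
-- iₐ < m < iₐ₊₁ and v_b < πₘ < v_{b+1}.
isOccurrenceᵇ : MeshPattern → ℕ → List ℕ → List ℕ → Bool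
isOccurrenceᵇ p n w is =
  orderIsoᵇ vals (τ p) ∧
  all (λ { (a , b) →
         all (λ m → not ( (at I a <ᵇ m) ∧ (m <ᵇ at I (suc a))
                        ∧ (at Vs b <ᵇ letter w m) ∧ (letter w m <ᵇ at Vs (suc b))))
             (positions n) })
      (R p)
  where
    vals = map (letter w) is
    I    = 0 ∷ is ++ [ suc n ]
    Vs   = 0 ∷ sort vals ++ [ suc n ]

occurrences : MeshPattern → ∀ {n} → Vec (Fin n) n → ℕ
occurrences p {n} π =
  length (filterᵇ (isOccurrenceᵇ p n (word π))
                 (choose (length (τ p)) (positions n)))

countWith : MeshPattern → ℕ → ℕ → ℕ
countWith p n ℓ =
  length (filterᵇ (λ π → occurrences p π ≡ᵇ ℓ) (S n))

_∼d_ : MeshPattern → MeshPattern → Set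
p ∼d q = ∀ (n ℓ : ℕ) → countWith p n ℓ ≡ countWith q n ℓ

R₄₆ : List (ℕ × ℕ)
R₄₆ = (1 , 2) ∷ (1 , 3) ∷ (2 , 1) ∷ (2 , 2) ∷ (2 , 3) ∷ (3 , 1) ∷ (3 , 2) ∷ (3 , 3) ∷ []

p123 : MeshPattern
p123 = mesh (1 ∷ 2 ∷ 3 ∷ []) R₄₆

p132 : MeshPattern
p132 = mesh (1 ∷ 3 ∷ 2 ∷ []) R₄₆

{-# OPTIONS --safe #-}
-- The shading R₄₆ leaves unshaded only the first column, the two lowest cells of the second
-- column and the lowest cells of the last two. Hence positions i < j < k of a permutation π form
-- an occurrence of 123 or of 132 exactly when πⱼ and πₖ are the last two of the letters after
-- position i that exceed πᵢ, they are the largest two of these letters, and they appear in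
-- increasing, respectively decreasing, order. Both statistics thus count the positions whose
-- larger followers end with their top pair in a prescribed order. The involution `exchange`
-- works from the right: when the first letter x is one of the two largest letters of x ∷ t, the
-- other one moves to the front and x takes its place in the image of t; otherwise x stays. It
-- commutes with deleting the letters below any threshold and reverses the order of top pairs,
-- so it carries the first count to the second.
module Submission where

open import Defs

open import Data.Bool using (Bool; true; false; _∧_; _∨_; not; if_then_else_; T)
open import Data.Bool.Properties using (∧-assoc; ∧-comm; ∧-zeroʳ; ∧-identityʳ; T-≡)
open import Data.Bool.Solver using (module ∨-∧-Solver)
open import Data.Empty using (⊥-elim)
open import Data.Fin using (Fin; zero; suc; toℕ)
open import Data.Fin.Properties using (toℕ-injective; suc-injective; 0≢1+n; toℕ<n)
open import Data.List using (List; []; _∷_; _++_; [_]; map; length; filterᵇ; upTo; null; allFin)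
open import Data.List.Membership.Propositional using (_∈_)
open import Data.List.Membership.Propositional.Properties
  using (∈-++⁺ʳ; ∈-++⁺ˡ; ∈-++⁻; ∈-filter⁺; ∈-filter⁻; ∈-allFin; ∈-map⁺; ∈-map⁻; ∈-concat⁺′)
open import Data.List.Membership.Propositional.Properties.WithK using (unique∧set⇒bag)
open import Data.List.Properties
  using (filter-++; length-++; length-map; map-injective; map-applyUpTo; map-∘; map-++; ++-assoc; ++-identityʳ)
open import Data.List.Relation.Binary.BagAndSetEquality using (∼bag⇒↭)
open import Data.List.Relation.Binary.Disjoint.Propositional using (Disjoint)
open import Data.List.Relation.Binary.Permutation.Propositional
  using (_↭_; ↭-refl; ↭-prep; ↭-swap; ↭-trans; ↭-sym; ↭⇒↭ₛ)
import Data.List.Relation.Binary.Permutation.Propositional.Properties as PermP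
import Data.List.Relation.Binary.Permutation.Setoid.Properties as PermSetoid
open import Data.List.Relation.Unary.All as All using (All; []; _∷_)
import Data.List.Relation.Unary.All.Properties as AllP
open import Data.List.Relation.Unary.AllPairs as AllPairs using ([]; _∷_)
import Data.List.Relation.Unary.AllPairs.Properties as AllPairsP
open import Data.List.Relation.Unary.Any using (here; there)
open import Data.List.Relation.Unary.Unique.Propositional using (Unique)
import Data.List.Relation.Unary.Unique.Propositional.Properties as UniqueP
open import Data.Nat using (ℕ; zero; suc; _+_; _<ᵇ_; _≡ᵇ_; _<_; _≤_; z≤n; s≤s)
open import Data.Nat.Properties
  using (<⇒<ᵇ; <ᵇ⇒<; ≡⇒≡ᵇ; ≡ᵇ⇒≡; +-identityʳ; ≤-refl; ≤-trans; ≤-antisym; <⇒≤; <-trans; <-≤-trans; ≤-<-trans;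
         <-cmp; ≮⇒≥; ≤∧≢⇒<; ≤-<-connex; n≤1+n; 1+n≰n)
import Data.Nat.Properties as ℕP
open import Data.Product as Product using (_×_; _,_; proj₁; proj₂; ∃-syntax)
open import Data.Sum as Sum using (_⊎_; inj₁; inj₂)
open import Data.Vec as Vec using (Vec; []; _∷_; lookup; toList)
import Data.Vec.Properties as VecP
open import Data.Vec.Relation.Binary.Equality.Cast using (cast-is-id)
open import Function using (_∘_; id; Equivalence; mk⇔)
open import Function.Definitions using (Injective)
open import Relation.Binary.Definitions using (tri<; tri≈; tri>)
open import Relation.Binary.PropositionalEquality
  using (_≡_; _≢_; refl; sym; trans; cong; cong₂; subst; setoid; module ≡-Reasoning)
open import Relation.Nullary.Decidable using (T?)

boolToℕ : Bool → ℕ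
boolToℕ true  = 1
boolToℕ false = 0

boolToℕ≤1 : ∀ b → boolToℕ b ≤ 1
boolToℕ≤1 true  = ≤-refl
boolToℕ≤1 false = z≤n

∧-true⁻ : ∀ {a b} → (a ∧ b) ≡ true → a ≡ true × b ≡ true
∧-true⁻ {true} {true} refl = refl , refl

∧-cong-guarded : ∀ {a a′ b b′} → a ≡ a′ → (a ≡ true → b ≡ b′) → (a ∧ b) ≡ (a′ ∧ b′)
∧-cong-guarded {false} refl _     = refl
∧-cong-guarded {true}  refl b≡b′ = b≡b′ refl

∧-regroup : ∀ a b c → not (a ∧ (b ∧ c)) ≡ not ((a ∧ b) ∧ c)
∧-regroup a b c = cong not (sym (∧-assoc a b c))

if-map : ∀ {A B : Set} (f : A → B) b (u v : A) → f (if b then u else v) ≡ (if b then f u else f v)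
if-map f true  u v = refl
if-map f false u v = refl

<ᵇ-true : ∀ {m n} → m < n → (m <ᵇ n) ≡ true
<ᵇ-true m<n = Equivalence.to T-≡ (<⇒<ᵇ m<n)

<ᵇ-false : ∀ {m n} → n ≤ m → (m <ᵇ n) ≡ false
<ᵇ-false {n = zero}      _         = refl
<ᵇ-false {suc m} {suc n} (s≤s n≤m) = <ᵇ-false n≤m

<ᵇ-true⁻ : ∀ {m n} → (m <ᵇ n) ≡ true → m < n
<ᵇ-true⁻ {m} {n} eq = <ᵇ⇒< m n (Equivalence.from T-≡ eq)

<ᵇ-false⁻ : ∀ {m n} → (m <ᵇ n) ≡ false → n ≤ m
<ᵇ-false⁻ eq = ≮⇒≥ (λ m<n → subst T eq (<⇒<ᵇ m<n))

<ᵇ-irrefl : ∀ n → (n <ᵇ n) ≡ false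
<ᵇ-irrefl n = <ᵇ-false {n} {n} ≤-refl

<ᵇ-asym : ∀ {m n} → (m <ᵇ n) ≡ true → (n <ᵇ m) ≡ false
<ᵇ-asym {m} {n} m<n = <ᵇ-false {n} {m} (<⇒≤ (<ᵇ-true⁻ {m} {n} m<n))

≡ᵇ-refl : ∀ n → (n ≡ᵇ n) ≡ true
≡ᵇ-refl n = Equivalence.to T-≡ (≡⇒≡ᵇ n n refl)

≡ᵇ-true⁻ : ∀ {m n} → (m ≡ᵇ n) ≡ true → m ≡ n
≡ᵇ-true⁻ {m} {n} eq = ≡ᵇ⇒≡ m n (Equivalence.from T-≡ eq)

≡ᵇ-false : ∀ {m n} → m ≢ n → (m ≡ᵇ n) ≡ false
≡ᵇ-false {m} {n} m≢n with m ≡ᵇ n in eq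
... | false = refl
... | true  = ⊥-elim (m≢n (≡ᵇ-true⁻ eq))

≡ᵇ-false⁻ : ∀ {m n} → (m ≡ᵇ n) ≡ false → m ≢ n
≡ᵇ-false⁻ {m} eq refl with () ← trans (sym (≡ᵇ-refl m)) eq

≡ᵇ-via-<ᵇ : ∀ m n → (m ≡ᵇ n) ≡ (not (m <ᵇ n) ∧ not (n <ᵇ m))
≡ᵇ-via-<ᵇ m n with <-cmp m n
... | tri< m<n m≢n _ rewrite ≡ᵇ-false m≢n | <ᵇ-true m<n = refl
... | tri≈ _ refl _ rewrite ≡ᵇ-refl m | <ᵇ-irrefl m = refl
... | tri> _ m≢n n<m rewrite ≡ᵇ-false m≢n | <ᵇ-true n<m | <ᵇ-false {m} {n} (<⇒≤ n<m) = refl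

between : ℕ → ℕ → ℕ → Bool
between lo hi m = (lo <ᵇ m) ∧ (m <ᵇ hi)

between-below : ∀ {lo hi u} → u ≤ lo → between lo hi u ≡ false
between-below {lo} {hi} {u} u≤lo = cong (_∧ (u <ᵇ hi)) (<ᵇ-false u≤lo)

between-above : ∀ {lo hi u} → hi ≤ u → between lo hi u ≡ false
between-above {lo} {hi} {u} hi≤u = trans (cong ((lo <ᵇ u) ∧_) (<ᵇ-false hi≤u)) (∧-zeroʳ (lo <ᵇ u))

between-inside : ∀ {lo hi u} → lo < u → u < hi → between lo hi u ≡ true
between-inside lo<u u<hi = cong₂ _∧_ (<ᵇ-true lo<u) (<ᵇ-true u<hi)

all-cong : ∀ {A : Set} {f g : A → Bool} {xs : List A} → All (λ x → f x ≡ g x) xs → all f xs ≡ all g xs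
all-cong []         = refl
all-cong (eq ∷ eqs) = cong₂ _∧_ eq (all-cong eqs)

all-true : ∀ {A : Set} (xs : List A) → all (λ _ → true) xs ≡ true
all-true []       = refl
all-true (_ ∷ xs) = all-true xs

all-∈ : ∀ {A : Set} {f : A → Bool} {xs x} → all f xs ≡ true → x ∈ xs → f x ≡ true
all-∈ {f = f} {x ∷ xs}  all≡ (here refl) with f x
... | true = refl
all-∈ {f = f} {x′ ∷ xs} all≡ (there x∈) with f x′
... | true = all-∈ all≡ x∈

all-intro : ∀ {A : Set} (f : A → Bool) xs → (∀ {x} → x ∈ xs → f x ≡ true) → all f xs ≡ true
all-intro f []       _      = refl
all-intro f (x ∷ xs) f≡true with f x | f≡true (here refl)
... | _ | refl = all-intro f xs (f≡true ∘ there)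

all-∧ : ∀ {A : Set} (f g : A → Bool) xs → (all f xs ∧ all g xs) ≡ all (λ x → f x ∧ g x) xs
all-∧ f g []       = refl
all-∧ f g (x ∷ xs) with f x | g x
... | false | _     = refl
... | true  | false = ∧-zeroʳ (all f xs)
... | true  | true  = all-∧ f g xs

all-swap : ∀ {A B : Set} (g : A → B → Bool) xs ys →
           all (λ x → all (g x) ys) xs ≡ all (λ y → all (λ x → g x y) xs) ys
all-swap g []       ys = sym (all-true ys)
all-swap g (x ∷ xs) ys = trans (cong (all (g x) ys ∧_) (all-swap g xs ys)) (all-∧ (g x) _ ys)

all-∷ʳ-∧ : ∀ {A : Set} (f : A → Bool) xs y b → (all f (xs ++ [ y ]) ∧ b) ≡ (all f xs ∧ (f y ∧ b))
all-∷ʳ-∧ f []       y b with f y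
... | true  = refl
... | false = refl
all-∷ʳ-∧ f (x ∷ xs) y b with f x
... | true  = all-∷ʳ-∧ f xs y b
... | false = refl

all-map : ∀ {A B : Set} (f : B → Bool) (g : A → B) xs → all f (map g xs) ≡ all (f ∘ g) xs
all-map f g []       = refl
all-map f g (x ∷ xs) = cong (f (g x) ∧_) (all-map f g xs)

upTo-suc : ∀ n → upTo (suc n) ≡ 0 ∷ map suc (upTo n)
upTo-suc n = cong (0 ∷_) (sym (map-applyUpTo id suc n))

all-upTo-suc : ∀ (f : ℕ → Bool) n → all f (upTo (suc n)) ≡ (f 0 ∧ all (f ∘ suc) (upTo n))
all-upTo-suc f n = trans (cong (all f) (upTo-suc n)) (cong (f 0 ∧_) (all-map f suc (upTo n)))

all-upTo-suc-true : ∀ (f : ℕ → Bool) n → f 0 ≡ true → all f (upTo (suc n)) ≡ all (f ∘ suc) (upTo n)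
all-upTo-suc-true f n f0 = trans (all-upTo-suc f n) (cong (_∧ all (f ∘ suc) (upTo n)) f0)

all-upTo-length : ∀ (f : Bool → ℕ → Bool) r →
                  all (λ m → f (m <ᵇ length r) (at r m)) (upTo (length r)) ≡ all (f true) r
all-upTo-length f []      = refl
all-upTo-length f (z ∷ r) = trans (all-upTo-suc _ (length r)) (cong (f true z ∧_) (all-upTo-length f r))

module _ {A : Set} where

  count-∷ : ∀ (p : A → Bool) x xs →
            length (filterᵇ p (x ∷ xs)) ≡ boolToℕ (p x) + length (filterᵇ p xs)
  count-∷ p x xs with p x
  ... | true  = refl
  ... | false = refl

  count-singleton : ∀ (p : A → Bool) x → length (filterᵇ p [ x ]) ≡ boolToℕ (p x)
  count-singleton p x = trans (count-∷ p x []) (+-identityʳ _)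

  count-++ : ∀ (p : A → Bool) xs ys →
             length (filterᵇ p (xs ++ ys)) ≡ length (filterᵇ p xs) + length (filterᵇ p ys)
  count-++ p xs ys = trans (cong length (filter-++ (T? ∘ p) xs ys)) (length-++ (filterᵇ p xs))

  filter-cong : ∀ {p q : A → Bool} {xs} → All (λ x → p x ≡ q x) xs → filterᵇ p xs ≡ filterᵇ q xs
  filter-cong {p} {q} {[]}     []         = refl
  filter-cong {p} {q} {x ∷ xs} (eq ∷ eqs) with p x | q x
  filter-cong {p} {q} {x ∷ xs} (refl ∷ eqs) | true  | true  = cong (x ∷_) (filter-cong eqs)
  filter-cong {p} {q} {x ∷ xs} (refl ∷ eqs) | false | false = filter-cong eqs

  count-cong : ∀ {p q : A → Bool} {xs} → All (λ x → p x ≡ q x) xs →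
               length (filterᵇ p xs) ≡ length (filterᵇ q xs)
  count-cong eqs = cong length (filter-cong eqs)

  count-↭ : ∀ (p : A → Bool) {xs ys} → xs ↭ ys → length (filterᵇ p xs) ≡ length (filterᵇ p ys)
  count-↭ p xs↭ys = PermP.↭-length (PermP.filter-↭ (T? ∘ p) xs↭ys)

  filter-∷ʳ : ∀ (p : A → Bool) xs y →
              filterᵇ p (xs ++ [ y ]) ≡ filterᵇ p xs ++ (if p y then [ y ] else [])
  filter-∷ʳ p xs y = trans (filter-++ (T? ∘ p) xs [ y ]) (cong (filterᵇ p xs ++_) singleton)
    where
      singleton : filterᵇ p [ y ] ≡ (if p y then [ y ] else [])
      singleton with p y
      ... | true  = refl
      ... | false = refl

filter-map : ∀ {A B : Set} (p : B → Bool) (f : A → B) xs →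
             filterᵇ p (map f xs) ≡ map f (filterᵇ (p ∘ f) xs)
filter-map p f []       = refl
filter-map p f (x ∷ xs) with p (f x)
... | true  = cong (f x ∷_) (filter-map p f xs)
... | false = filter-map p f xs

count-map : ∀ {A B : Set} (p : B → Bool) (f : A → B) xs →
            length (filterᵇ p (map f xs)) ≡ length (filterᵇ (p ∘ f) xs)
count-map p f xs = trans (cong length (filter-map p f xs)) (length-map f (filterᵇ (p ∘ f) xs))

Unique-middle : ∀ {A : Set} xs {v : A} {ys} → Unique (xs ++ v ∷ ys) → All (_≢ v) (xs ++ ys)
Unique-middle []       (v∉ys ∷ _)   = All.map (λ v≢u u≡v → v≢u (sym u≡v)) v∉ys
Unique-middle (x ∷ xs) (x∉rest ∷ U) = All.lookup x∉rest (∈-++⁺ʳ xs (here refl)) ∷ Unique-middle xs U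

Unique-↭ : ∀ {A : Set} {xs ys : List A} → xs ↭ ys → Unique xs → Unique ys
Unique-↭ xs↭ys = PermSetoid.Unique-resp-↭ (setoid _) (↭⇒↭ₛ xs↭ys)

Unique-map : ∀ {A B : Set} (f : A → B) {xs} → Unique xs → (∀ {a b} → a ∈ xs → b ∈ xs → f a ≡ f b → a ≡ b) →
             Unique (map f xs)
Unique-map f {[]}     []          inj = []
Unique-map f {x ∷ xs} (x∉xs ∷ U) inj =
  AllP.map⁺ (All.tabulate (λ y∈ fx≡fy → All.lookup x∉xs y∈ (inj (here refl) (there y∈) fx≡fy)))
  ∷ Unique-map f U (λ a∈ b∈ → inj (there a∈) (there b∈))

map-involution-↭ : ∀ {A : Set} (f : A → A) {xs} → Unique xs → (∀ {x} → x ∈ xs → f x ∈ xs) →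
                   (∀ {x} → x ∈ xs → f (f x) ≡ x) → map f xs ↭ xs
map-involution-↭ f {xs} U closed involutive =
  ∼bag⇒↭ (unique∧set⇒bag (Unique-map f U injective) U (mk⇔ into onto))
  where
    injective : ∀ {a b} → a ∈ xs → b ∈ xs → f a ≡ f b → a ≡ b
    injective a∈ b∈ fa≡fb = trans (sym (involutive a∈)) (trans (cong f fa≡fb) (involutive b∈))
    into : ∀ {v} → v ∈ map f xs → v ∈ xs
    into v∈ with ∈-map⁻ f v∈
    ... | _ , x∈ , refl = closed x∈
    onto : ∀ {v} → v ∈ xs → v ∈ map f xs
    onto v∈ = subst (_∈ map f xs) (involutive v∈) (∈-map⁺ f (closed v∈))

choose-map : ∀ (f : ℕ → ℕ) k xs → choose k (map f xs) ≡ map (map f) (choose k xs)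
choose-map f zero    xs       = refl
choose-map f (suc k) []       = refl
choose-map f (suc k) (x ∷ xs) = begin
  map (f x ∷_) (choose k (map f xs)) ++ choose (suc k) (map f xs)
    ≡⟨ cong₂ _++_ (cong (map (f x ∷_)) (choose-map f k xs)) (choose-map f (suc k) xs) ⟩
  map (f x ∷_) (map (map f) (choose k xs)) ++ map (map f) (choose (suc k) xs)
    ≡⟨ cong (_++ map (map f) (choose (suc k) xs))
            (trans (sym (map-∘ (choose k xs))) (map-∘ (choose k xs))) ⟩
  map (map f) (map (x ∷_) (choose k xs)) ++ map (map f) (choose (suc k) xs)
    ≡⟨ map-++ (map f) (map (x ∷_) (choose k xs)) (choose (suc k) xs) ⟨
  map (map f) (map (x ∷_) (choose k xs) ++ choose (suc k) xs) ∎
  where open ≡-Reasoning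

choose-length : ∀ k (xs : List ℕ) → All (λ is → length is ≡ k) (choose k xs)
choose-length zero    xs       = refl ∷ []
choose-length (suc k) []       = []
choose-length (suc k) (x ∷ xs) =
  AllP.++⁺ (AllP.map⁺ (All.map (cong suc) (choose-length k xs))) (choose-length (suc k) xs)

count-choose-cong : ∀ {p q : List ℕ → Bool} k xs → (∀ is → length is ≡ k → p is ≡ q is) →
                    length (filterᵇ p (choose k xs)) ≡ length (filterᵇ q (choose k xs))
count-choose-cong k xs eq = count-cong (All.map (eq _) (choose-length k xs))

count-choose-upTo-suc : ∀ (p : List ℕ → Bool) k n →
  length (filterᵇ p (choose (suc k) (upTo (suc n))))
    ≡ length (filterᵇ (p ∘ (0 ∷_) ∘ map suc) (choose k (upTo n)))
      + length (filterᵇ (p ∘ map suc) (choose (suc k) (upTo n)))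
count-choose-upTo-suc p k n = begin
  length (filterᵇ p (choose (suc k) (upTo (suc n))))
    ≡⟨ cong (λ xs → length (filterᵇ p (choose (suc k) xs))) (upTo-suc n) ⟩
  length (filterᵇ p (map (0 ∷_) (choose k (map suc (upTo n))) ++ choose (suc k) (map suc (upTo n))))
    ≡⟨ count-++ p (map (0 ∷_) (choose k (map suc (upTo n)))) (choose (suc k) (map suc (upTo n))) ⟩
  length (filterᵇ p (map (0 ∷_) (choose k (map suc (upTo n)))))
    + length (filterᵇ p (choose (suc k) (map suc (upTo n))))
    ≡⟨ cong₂ _+_ (cong (length ∘ filterᵇ p ∘ map (0 ∷_)) (choose-map suc k (upTo n)))
                 (cong (length ∘ filterᵇ p) (choose-map suc (suc k) (upTo n))) ⟩
  length (filterᵇ p (map (0 ∷_) (map (map suc) (choose k (upTo n)))))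
    + length (filterᵇ p (map (map suc) (choose (suc k) (upTo n))))
    ≡⟨ cong₂ _+_ (trans (count-map p (0 ∷_) (map (map suc) (choose k (upTo n))))
                        (count-map (p ∘ (0 ∷_)) (map suc) (choose k (upTo n))))
                 (count-map p (map suc) (choose (suc k) (upTo n))) ⟩
  length (filterᵇ (p ∘ (0 ∷_) ∘ map suc) (choose k (upTo n)))
    + length (filterᵇ (p ∘ map suc) (choose (suc k) (upTo n))) ∎
  where open ≡-Reasoning

-- Occurrences of length-3 patterns with unshaded first column

record TripleTest : Set where
  field
    order             : ℕ → ℕ → ℕ → Bool
    zone₁ zone₂ zone₃ : ℕ → ℕ → ℕ → ℕ → Bool

-- R₁ and R₂ collect the letters already passed in columns 1 and 2.
module TripleCount (test : TripleTest) where
  open TripleTest test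

  singles : ℕ → ℕ → List ℕ → List ℕ → List ℕ → ℕ
  singles x y R₁ R₂ []      = 0
  singles x y R₁ R₂ (z ∷ r) =
    boolToℕ (order x y z ∧ (all (zone₁ x y z) R₁ ∧ (all (zone₂ x y z) R₂ ∧ all (zone₃ x y z) r)))
    + singles x y R₁ (R₂ ++ [ z ]) r

  pairs : ℕ → List ℕ → List ℕ → ℕ
  pairs x R₁ []      = 0
  pairs x R₁ (y ∷ s) = singles x y R₁ [] s + pairs x (R₁ ++ [ y ]) s

  triples : List ℕ → ℕ
  triples []      = 0
  triples (x ∷ t) = pairs x [] t + triples t

-- avoid a b c c₁ c₂ c₃ u says that a letter u in the columns flagged by c₁ c₂ c₃ of an occurrence
-- with letters a b c lies in no shaded box. Positions here are 0-based, unlike in isOccurrenceᵇ.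
module ByPositions (order : ℕ → ℕ → ℕ → Bool)
                   (avoid : ℕ → ℕ → ℕ → Bool → Bool → Bool → ℕ → Bool)
                   (avoid-outside : ∀ a b c u → avoid a b c false false false u ≡ true) where

  test : TripleTest
  test = record
    { order = order
    ; zone₁ = λ a b c → avoid a b c true false false
    ; zone₂ = λ a b c → avoid a b c false true false
    ; zone₃ = λ a b c → avoid a b c false false true
    }
  open TripleTest test using (zone₁; zone₂; zone₃)
  open TripleCount test

  points : ℕ → ℕ → ℕ → (ℕ → Bool) → (ℕ → Bool) → (ℕ → Bool) → List ℕ → Bool
  points a b c col₁ col₂ col₃ w =
    all (λ m → avoid a b c (col₁ m) (col₂ m) (col₃ m) (at w m)) (upTo (length w))

  holdsAt : List ℕ → List ℕ → Bool
  holdsAt w (i ∷ j ∷ k ∷ []) =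
    order (at w i) (at w j) (at w k)
    ∧ points (at w i) (at w j) (at w k) (between i j) (between j k) (between k (length w)) w
  holdsAt w _ = false

  pairAt : ℕ → List ℕ → List ℕ → List ℕ → Bool
  pairAt x R₁ t (j ∷ k ∷ []) =
    order x (at t j) (at t k)
    ∧ (all (zone₁ x (at t j) (at t k)) R₁
       ∧ points x (at t j) (at t k) (_<ᵇ j) (between j k) (between k (length t)) t)
  pairAt x R₁ t _ = false

  singleAt : ℕ → ℕ → List ℕ → List ℕ → List ℕ → List ℕ → Bool
  singleAt x y R₁ R₂ s (k ∷ []) =
    order x y (at s k)
    ∧ (all (zone₁ x y (at s k)) R₁
       ∧ (all (zone₂ x y (at s k)) R₂
          ∧ points x y (at s k) (λ _ → false) (_<ᵇ k) (between k (length s)) s))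
  singleAt x y R₁ R₂ s _ = false

  singleAt-count : ∀ x y R₁ R₂ s →
                   length (filterᵇ (singleAt x y R₁ R₂ s) (choose 1 (upTo (length s)))) ≡ singles x y R₁ R₂ s
  singleAt-count x y R₁ R₂ []      = refl
  singleAt-count x y R₁ R₂ (z ∷ r) = begin
    length (filterᵇ (singleAt x y R₁ R₂ (z ∷ r)) (choose 1 (upTo (suc (length r)))))
      ≡⟨ count-choose-upTo-suc (singleAt x y R₁ R₂ (z ∷ r)) 0 (length r) ⟩
    length (filterᵇ (singleAt x y R₁ R₂ (z ∷ r) ∘ (0 ∷_) ∘ map suc) [ [] ])
      + length (filterᵇ (singleAt x y R₁ R₂ (z ∷ r) ∘ map suc) (choose 1 (upTo (length r))))
      ≡⟨ cong₂ _+_ (trans (count-singleton (singleAt x y R₁ R₂ (z ∷ r) ∘ (0 ∷_) ∘ map suc) [])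
                          (cong boolToℕ atHead))
                   (trans (count-choose-cong 1 (upTo (length r)) inTail)
                          (singleAt-count x y R₁ (R₂ ++ [ z ]) r)) ⟩
    singles x y R₁ R₂ (z ∷ r) ∎
    where
      open ≡-Reasoning
      atHead : singleAt x y R₁ R₂ (z ∷ r) (0 ∷ [])
               ≡ (order x y z ∧ (all (zone₁ x y z) R₁ ∧ (all (zone₂ x y z) R₂ ∧ all (zone₃ x y z) r)))
      atHead = cong (λ b → order x y z ∧ (all (zone₁ x y z) R₁ ∧ (all (zone₂ x y z) R₂ ∧ b)))
                    (trans (all-upTo-suc-true _ (length r) (avoid-outside x y z z))
                           (all-upTo-length (λ e u → avoid x y z false false e u) r))
      inTail : ∀ ks → length ks ≡ 1 →
               singleAt x y R₁ R₂ (z ∷ r) (map suc ks) ≡ singleAt x y R₁ (R₂ ++ [ z ]) r ks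
      inTail (k ∷ []) refl =
        cong (order x y (at r k) ∧_)
          (trans (cong (λ b → all (zone₁ x y (at r k)) R₁ ∧ (all (zone₂ x y (at r k)) R₂ ∧ b))
                       (all-upTo-suc _ (length r)))
                 (cong (all (zone₁ x y (at r k)) R₁ ∧_)
                       (sym (all-∷ʳ-∧ (zone₂ x y (at r k)) R₂ z
                                      (points x y (at r k) (λ _ → false) (_<ᵇ k) (between k (length r)) r)))))

  pairAt-count : ∀ x R₁ t → length (filterᵇ (pairAt x R₁ t) (choose 2 (upTo (length t)))) ≡ pairs x R₁ t
  pairAt-count x R₁ []      = refl
  pairAt-count x R₁ (y ∷ s) = begin
    length (filterᵇ (pairAt x R₁ (y ∷ s)) (choose 2 (upTo (suc (length s)))))
      ≡⟨ count-choose-upTo-suc (pairAt x R₁ (y ∷ s)) 1 (length s) ⟩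
    length (filterᵇ (pairAt x R₁ (y ∷ s) ∘ (0 ∷_) ∘ map suc) (choose 1 (upTo (length s))))
      + length (filterᵇ (pairAt x R₁ (y ∷ s) ∘ map suc) (choose 2 (upTo (length s))))
      ≡⟨ cong₂ _+_ (trans (count-choose-cong 1 (upTo (length s)) atHead) (singleAt-count x y R₁ [] s))
                   (trans (count-choose-cong 2 (upTo (length s)) inTail) (pairAt-count x (R₁ ++ [ y ]) s)) ⟩
    pairs x R₁ (y ∷ s) ∎
    where
      open ≡-Reasoning
      atHead : ∀ ks → length ks ≡ 1 → pairAt x R₁ (y ∷ s) (0 ∷ map suc ks) ≡ singleAt x y R₁ [] s ks
      atHead (k ∷ []) refl =
        cong (λ b → order x y (at s k) ∧ (all (zone₁ x y (at s k)) R₁ ∧ b))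
             (all-upTo-suc-true _ (length s) (avoid-outside x y (at s k) y))
      inTail : ∀ ks → length ks ≡ 2 → pairAt x R₁ (y ∷ s) (map suc ks) ≡ pairAt x (R₁ ++ [ y ]) s ks
      inTail (j ∷ k ∷ []) refl =
        cong (order x (at s j) (at s k) ∧_)
          (trans (cong (all (zone₁ x (at s j) (at s k)) R₁ ∧_) (all-upTo-suc _ (length s)))
                 (sym (all-∷ʳ-∧ (zone₁ x (at s j) (at s k)) R₁ y
                                (points x (at s j) (at s k) (_<ᵇ j) (between j k) (between k (length s)) s))))

  holdsAt-count : ∀ w → length (filterᵇ (holdsAt w) (choose 3 (upTo (length w)))) ≡ triples w
  holdsAt-count []      = refl
  holdsAt-count (x ∷ t) = begin
    length (filterᵇ (holdsAt (x ∷ t)) (choose 3 (upTo (suc (length t)))))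
      ≡⟨ count-choose-upTo-suc (holdsAt (x ∷ t)) 2 (length t) ⟩
    length (filterᵇ (holdsAt (x ∷ t) ∘ (0 ∷_) ∘ map suc) (choose 2 (upTo (length t))))
      + length (filterᵇ (holdsAt (x ∷ t) ∘ map suc) (choose 3 (upTo (length t))))
      ≡⟨ cong₂ _+_ (trans (count-choose-cong 2 (upTo (length t)) atHead) (pairAt-count x [] t))
                   (trans (count-choose-cong 3 (upTo (length t)) inTail) (holdsAt-count t)) ⟩
    triples (x ∷ t) ∎
    where
      open ≡-Reasoning
      atHead : ∀ ks → length ks ≡ 2 → holdsAt (x ∷ t) (0 ∷ map suc ks) ≡ pairAt x [] t ks
      atHead (j ∷ k ∷ []) refl =
        cong (order x (at t j) (at t k) ∧_) (all-upTo-suc-true _ (length t) (avoid-outside x (at t j) (at t k) x))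
      inTail : ∀ ks → length ks ≡ 3 → holdsAt (x ∷ t) (map suc ks) ≡ holdsAt t ks
      inTail (i ∷ j ∷ k ∷ []) refl =
        cong (order (at t i) (at t j) (at t k) ∧_)
             (all-upTo-suc-true _ (length t) (avoid-outside (at t i) (at t j) (at t k) x))

inColumn : List ℕ → ℕ → ℕ → Bool
inColumn I a m = between (at I a) (at I (suc a)) m

avoids : List (ℕ × ℕ) → (ℕ → Bool) → List ℕ → ℕ → Bool
avoids R column V u = all (λ { (a , b) → not (column a ∧ between (at V b) (at V (suc b)) u) }) R

isOccurrence-pointwise : ∀ p n w is →
  isOccurrenceᵇ p n w is
    ≡ (orderIsoᵇ (map (letter w) is) (τ p)
       ∧ all (λ m → avoids (R p) (λ a → inColumn (0 ∷ is ++ [ suc n ]) a m)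
                                 (0 ∷ sort (map (letter w) is) ++ [ suc n ]) (letter w m))
             (positions n))
isOccurrence-pointwise p n w is =
  cong (orderIsoᵇ (map (letter w) is) (τ p) ∧_)
       (trans (all-swap _ (R p) (positions n))
              (all-cong (All.universal
                (λ m → all-cong (All.universal (λ { (a , b) → ∧-regroup (at I a <ᵇ m) (m <ᵇ at I (suc a)) _ })
                                               (R p)))
                (positions n))))
  where
    I : List ℕ
    I = 0 ∷ is ++ [ suc n ]

-- The shading R₄₆

columns : Bool → Bool → Bool → ℕ → Bool
columns c₁ c₂ c₃ 1 = c₁
columns c₁ c₂ c₃ 2 = c₂
columns c₁ c₂ c₃ 3 = c₃
columns c₁ c₂ c₃ _ = false

rowBounds : ℕ → ℕ → ℕ → ℕ → List ℕ
rowBounds B a b c = 0 ∷ sort (a ∷ b ∷ c ∷ []) ++ [ B ]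

avoid₄₆ : ℕ → ℕ → ℕ → ℕ → Bool → Bool → Bool → ℕ → Bool
avoid₄₆ B a b c c₁ c₂ c₃ = avoids R₄₆ (columns c₁ c₂ c₃) (rowBounds B a b c)

module Shading₄₆ (σ : List ℕ) (B : ℕ) =
  ByPositions (λ a b c → orderIsoᵇ (a ∷ b ∷ c ∷ []) σ) (avoid₄₆ B) (λ _ _ _ _ → refl)

occurrences-as-triples : ∀ σ n w → length w ≡ n →
  length (filterᵇ (isOccurrenceᵇ (mesh σ R₄₆) n w) (choose 3 (positions n)))
    ≡ TripleCount.triples (Shading₄₆.test σ (suc n)) w
occurrences-as-triples σ n w refl = begin
  length (filterᵇ (isOccurrenceᵇ (mesh σ R₄₆) n w) (choose 3 (map suc (upTo n))))
    ≡⟨ cong (length ∘ filterᵇ (isOccurrenceᵇ (mesh σ R₄₆) n w)) (choose-map suc 3 (upTo n)) ⟩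
  length (filterᵇ (isOccurrenceᵇ (mesh σ R₄₆) n w) (map (map suc) (choose 3 (upTo n))))
    ≡⟨ count-map _ (map suc) (choose 3 (upTo n)) ⟩
  length (filterᵇ (isOccurrenceᵇ (mesh σ R₄₆) n w ∘ map suc) (choose 3 (upTo n)))
    ≡⟨ count-choose-cong 3 (upTo n) pointwise ⟩
  length (filterᵇ (holdsAt w) (choose 3 (upTo n)))
    ≡⟨ holdsAt-count w ⟩
  TripleCount.triples test w ∎
  where
    open ≡-Reasoning
    open Shading₄₆ σ (suc n)
    -- Unfolding the eight boxes of R₄₆ turns the column tests inColumn into the flags of avoid₄₆.
    pointwise : ∀ is → length is ≡ 3 → isOccurrenceᵇ (mesh σ R₄₆) n w (map suc is) ≡ holdsAt w is
    pointwise (i ∷ j ∷ k ∷ []) refl =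
      trans (isOccurrence-pointwise (mesh σ R₄₆) n w (suc i ∷ suc j ∷ suc k ∷ []))
            (cong (orderIsoᵇ (at w i ∷ at w j ∷ at w k ∷ []) σ ∧_) (all-map _ suc (upTo n)))

module _ where
  open TripleTest

  Fresh : ℕ → ℕ → ℕ → ℕ → Set
  Fresh B y z u = u ≢ y × u ≢ z × u < B

  record Agree (B : ℕ) (t₁ t₂ : TripleTest) : Set where
    field
      order-≡ : ∀ x y z → order t₁ x y z ≡ order t₂ x y z
      zone₁-≡ : ∀ {x y z u} → order t₁ x y z ≡ true → Fresh B y z u → zone₁ t₁ x y z u ≡ zone₁ t₂ x y z u
      zone₂-≡ : ∀ {x y z u} → order t₁ x y z ≡ true → Fresh B y z u → zone₂ t₁ x y z u ≡ zone₂ t₂ x y z u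
      zone₃-≡ : ∀ {x y z u} → order t₁ x y z ≡ true → Fresh B y z u → zone₃ t₁ x y z u ≡ zone₃ t₂ x y z u

fresh-split : ∀ {B y z} R₁ R₂ {r} → Unique (R₁ ++ y ∷ R₂ ++ z ∷ r) → All (_< B) (R₁ ++ y ∷ R₂ ++ z ∷ r) →
              All (Fresh B y z) R₁ × All (Fresh B y z) R₂ × All (Fresh B y z) r
fresh-split {B} {y} {z} R₁ R₂ {r} U A =
  zip₃ (proj₁ ≢y₁) (proj₁ ≢z₁) (proj₁ <B₁) ,
  zip₃ (proj₁ ≢y₂) (All.tail (proj₂ ≢z₁)) (proj₁ <B₂) ,
  zip₃ (All.tail (proj₂ ≢y₂)) (proj₂ ≢z) (All.tail (proj₂ <B₂))
  where
    zip₃ : ∀ {P Q S : ℕ → Set} {xs} → All P xs → All Q xs → All S xs → All (λ u → P u × Q u × S u) xs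
    zip₃ p q s = All.zip (p , All.zip (q , s))
    ≢y₁ : All (_≢ y) R₁ × All (_≢ y) (R₂ ++ z ∷ r)
    ≢y₁ = AllP.++⁻ R₁ (Unique-middle R₁ U)
    ≢y₂ : All (_≢ y) R₂ × All (_≢ y) (z ∷ r)
    ≢y₂ = AllP.++⁻ R₂ (proj₂ ≢y₁)
    ≢z : All (_≢ z) (R₁ ++ y ∷ R₂) × All (_≢ z) r
    ≢z = AllP.++⁻ (R₁ ++ y ∷ R₂) (Unique-middle (R₁ ++ y ∷ R₂) (subst Unique (sym (++-assoc R₁ (y ∷ R₂) (z ∷ r))) U))
    ≢z₁ : All (_≢ z) R₁ × All (_≢ z) (y ∷ R₂)
    ≢z₁ = AllP.++⁻ R₁ (proj₁ ≢z)
    <B₁ : All (_< B) R₁ × All (_< B) (y ∷ R₂ ++ z ∷ r)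
    <B₁ = AllP.++⁻ R₁ A
    <B₂ : All (_< B) R₂ × All (_< B) (z ∷ r)
    <B₂ = AllP.++⁻ R₂ (All.tail (proj₂ <B₁))

module _ {B : ℕ} {t₁ t₂ : TripleTest} (agree : Agree B t₁ t₂) where
  open Agree agree
  open TripleTest
  private
    module C₁ = TripleCount t₁
    module C₂ = TripleCount t₂

  singles-cong : ∀ x y R₁ R₂ s → Unique (R₁ ++ y ∷ R₂ ++ s) → All (_< B) (R₁ ++ y ∷ R₂ ++ s) →
                 C₁.singles x y R₁ R₂ s ≡ C₂.singles x y R₁ R₂ s
  singles-cong x y R₁ R₂ []      _ _ = refl
  singles-cong x y R₁ R₂ (z ∷ r) U A =
    cong₂ _+_ (cong boolToℕ (∧-cong-guarded (order-≡ x y z) zones))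
              (singles-cong x y R₁ (R₂ ++ [ z ]) r (subst Unique moved U) (subst (All (_< B)) moved A))
    where
      moved : R₁ ++ y ∷ R₂ ++ z ∷ r ≡ R₁ ++ y ∷ (R₂ ++ [ z ]) ++ r
      moved = cong (λ l → R₁ ++ y ∷ l) (sym (++-assoc R₂ [ z ] r))
      zones : order t₁ x y z ≡ true →
              (all (zone₁ t₁ x y z) R₁ ∧ (all (zone₂ t₁ x y z) R₂ ∧ all (zone₃ t₁ x y z) r))
                ≡ (all (zone₁ t₂ x y z) R₁ ∧ (all (zone₂ t₂ x y z) R₂ ∧ all (zone₃ t₂ x y z) r))
      zones ord with fresh-split R₁ R₂ U A
      ... | fresh₁ , fresh₂ , fresh₃ =
        cong₂ _∧_ (all-cong (All.map (zone₁-≡ ord) fresh₁))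
                  (cong₂ _∧_ (all-cong (All.map (zone₂-≡ ord) fresh₂)) (all-cong (All.map (zone₃-≡ ord) fresh₃)))

  pairs-cong : ∀ x R₁ s → Unique (R₁ ++ s) → All (_< B) (R₁ ++ s) → C₁.pairs x R₁ s ≡ C₂.pairs x R₁ s
  pairs-cong x R₁ []      _ _ = refl
  pairs-cong x R₁ (y ∷ s) U A =
    cong₂ _+_ (singles-cong x y R₁ [] s U A)
              (pairs-cong x (R₁ ++ [ y ]) s (subst Unique moved U) (subst (All (_< B)) moved A))
    where
      moved : R₁ ++ y ∷ s ≡ (R₁ ++ [ y ]) ++ s
      moved = sym (++-assoc R₁ [ y ] s)

  triples-cong : ∀ w → Unique w → All (_< B) w → C₁.triples w ≡ C₂.triples w
  triples-cong []      _       _       = refl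
  triples-cong (x ∷ t) (_ ∷ U) (_ ∷ A) = cong₂ _+_ (pairs-cong x [] t U A) (triples-cong t U A)

data Order : Set where
  increasing decreasing : Order

inOrder : Order → ℕ → ℕ → Bool
inOrder increasing a b = a <ᵇ b
inOrder decreasing a b = b <ᵇ a

below : ℕ → ℕ → ℕ → Bool
below p q e = (e <ᵇ p) ∧ (e <ᵇ q)

notAbove : ℕ → ℕ → Bool
notAbove x u = not (x <ᵇ u)

topPairOrder : Order → ℕ → ℕ → ℕ → Bool
topPairOrder o x y z = (x <ᵇ y) ∧ ((x <ᵇ z) ∧ inOrder o y z)

topPairTest : Order → TripleTest
topPairTest o = record
  { order = topPairOrder o
  ; zone₁ = λ x y z → below y z
  ; zone₂ = λ x y z → notAbove x
  ; zone₃ = λ x y z → notAbove x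
  }

orderIso-123 : ∀ x y z → orderIsoᵇ (x ∷ y ∷ z ∷ []) (1 ∷ 2 ∷ 3 ∷ []) ≡ topPairOrder increasing x y z
orderIso-123 x y z with x <ᵇ x | <ᵇ-irrefl x | y <ᵇ y | <ᵇ-irrefl y | z <ᵇ z | <ᵇ-irrefl z | x <ᵇ y in xy
... | _ | refl | _ | refl | _ | refl | false = refl
... | _ | refl | _ | refl | _ | refl | true with y <ᵇ x | <ᵇ-asym {x} {y} xy | x <ᵇ z in xz
...   | _ | refl | false = refl
...   | _ | refl | true with z <ᵇ x | <ᵇ-asym {x} {z} xz | y <ᵇ z in yz
...     | _ | refl | false = refl
...     | _ | refl | true with z <ᵇ y | <ᵇ-asym {y} {z} yz
...       | _ | refl = refl

orderIso-132 : ∀ x y z → orderIsoᵇ (x ∷ y ∷ z ∷ []) (1 ∷ 3 ∷ 2 ∷ []) ≡ topPairOrder decreasing x y z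
orderIso-132 x y z with x <ᵇ x | <ᵇ-irrefl x | y <ᵇ y | <ᵇ-irrefl y | z <ᵇ z | <ᵇ-irrefl z | x <ᵇ y in xy
... | _ | refl | _ | refl | _ | refl | false = refl
... | _ | refl | _ | refl | _ | refl | true with y <ᵇ x | <ᵇ-asym {x} {y} xy | x <ᵇ z in xz
...   | _ | refl | false = refl
...   | _ | refl | true with z <ᵇ x | <ᵇ-asym {x} {z} xz | z <ᵇ y in zy | y <ᵇ z in yz
...     | _ | refl | false | false = refl
...     | _ | refl | false | true  = refl
...     | _ | refl | true  | false = refl
...     | _ | refl | true  | true  with () ← trans (sym (<ᵇ-asym {z} {y} zy)) yz

sort-sorted : ∀ {a b c} → a < b → b < c → sort (a ∷ b ∷ c ∷ []) ≡ a ∷ b ∷ c ∷ []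
sort-sorted {a} {b} {c} a<b b<c with b <ᵇ c | <ᵇ-true b<c
... | _ | refl with a <ᵇ b | <ᵇ-true a<b
...   | _ | refl = refl

sort-swapped : ∀ {a b c} → a < c → c < b → sort (a ∷ b ∷ c ∷ []) ≡ a ∷ c ∷ b ∷ []
sort-swapped {a} {b} {c} a<c c<b with b <ᵇ c | <ᵇ-false {b} {c} (<⇒≤ c<b)
... | _ | refl with a <ᵇ c | <ᵇ-true a<c
...   | _ | refl = refl

-- The left-hand sides are avoid₄₆ in column 1 and in columns 2 or 3, for row bounds 0 v₁ v₂ v₃ B.
zone₁-sorted : ∀ {v₂ v₃ B u} → v₂ < v₃ → u ≢ v₂ → u ≢ v₃ → u < B →
               (not (between v₂ v₃ u) ∧ (not (between v₃ B u) ∧ true)) ≡ (u <ᵇ v₂)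
zone₁-sorted {v₂} {v₃} {B} {u} v₂<v₃ u≢v₂ u≢v₃ u<B with <-cmp u v₂
... | tri≈ _ u≡v₂ _ = ⊥-elim (u≢v₂ u≡v₂)
... | tri< u<v₂ _ _
  rewrite between-below {v₂} {v₃} (<⇒≤ u<v₂) | between-below {v₃} {B} (<⇒≤ (<-trans u<v₂ v₂<v₃)) | <ᵇ-true u<v₂
  = refl
... | tri> _ _ v₂<u with <-cmp u v₃
...   | tri≈ _ u≡v₃ _ = ⊥-elim (u≢v₃ u≡v₃)
...   | tri< u<v₃ _ _ rewrite between-inside v₂<u u<v₃ | <ᵇ-false {u} {v₂} (<⇒≤ v₂<u) = refl
...   | tri> _ _ v₃<u
  rewrite between-above {v₂} {v₃} (<⇒≤ v₃<u) | between-inside v₃<u u<B | <ᵇ-false {u} {v₂} (<⇒≤ v₂<u)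
  = refl

zone₂-sorted : ∀ {v₁ v₂ v₃ B u} → v₁ < v₂ → v₂ < v₃ → u ≢ v₂ → u ≢ v₃ → u < B →
               (not (between v₁ v₂ u) ∧ (not (between v₂ v₃ u) ∧ (not (between v₃ B u) ∧ true))) ≡ not (v₁ <ᵇ u)
zone₂-sorted {v₁} {v₂} {v₃} {B} {u} v₁<v₂ v₂<v₃ u≢v₂ u≢v₃ u<B with <-cmp v₁ u
... | tri< v₁<u _ _ with <-cmp u v₂
...   | tri< u<v₂ _ _ rewrite between-inside v₁<u u<v₂ | <ᵇ-true v₁<u = refl
...   | tri≈ _ u≡v₂ _ = ⊥-elim (u≢v₂ u≡v₂)
...   | tri> _ _ v₂<u rewrite between-above {v₁} {v₂} (<⇒≤ v₂<u) | <ᵇ-true v₁<u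
  = trans (zone₁-sorted {v₂} {v₃} {B} v₂<v₃ u≢v₂ u≢v₃ u<B) (<ᵇ-false {u} {v₂} (<⇒≤ v₂<u))
zone₂-sorted {v₁} {v₂} {v₃} {B} {u} v₁<v₂ v₂<v₃ _ _ _ | tri≈ _ refl _
  rewrite between-below {v₁} {v₂} {v₁} ≤-refl | between-below {v₂} {v₃} (<⇒≤ v₁<v₂)
        | between-below {v₃} {B} (<⇒≤ (<-trans v₁<v₂ v₂<v₃)) | <ᵇ-irrefl v₁
  = refl
zone₂-sorted {v₁} {v₂} {v₃} {B} {u} v₁<v₂ v₂<v₃ _ _ _ | tri> _ _ u<v₁
  rewrite between-below {v₁} {v₂} (<⇒≤ u<v₁) | between-below {v₂} {v₃} (<⇒≤ (<-trans u<v₁ v₁<v₂))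
        | between-below {v₃} {B} (<⇒≤ (<-trans (<-trans u<v₁ v₁<v₂) v₂<v₃)) | <ᵇ-false {v₁} {u} (<⇒≤ u<v₁)
  = refl

lower upper : Order → ℕ → ℕ → ℕ
lower increasing y z = y
lower decreasing y z = z
upper increasing y z = z
upper decreasing y z = y

module _ {y z : ℕ} where

  lower<upper : ∀ o → inOrder o y z ≡ true → lower o y z < upper o y z
  lower<upper increasing yz = <ᵇ-true⁻ {y} {z} yz
  lower<upper decreasing zy = <ᵇ-true⁻ {z} {y} zy

  lower-above : ∀ o {x} → x < y → x < z → x < lower o y z
  lower-above increasing x<y _   = x<y
  lower-above decreasing _   x<z = x<z

  sort-topPair : ∀ o {x} → x < y → x < z → inOrder o y z ≡ true →
                 sort (x ∷ y ∷ z ∷ []) ≡ x ∷ lower o y z ∷ upper o y z ∷ []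
  sort-topPair increasing x<y x<z yz = sort-sorted x<y (lower<upper increasing yz)
  sort-topPair decreasing x<y x<z zy = sort-swapped x<z (lower<upper decreasing zy)

  below-lower : ∀ o u → inOrder o y z ≡ true → below y z u ≡ (u <ᵇ lower o y z)
  below-lower increasing u yz with u <ᵇ y in uy
  ... | false = refl
  ... | true  = <ᵇ-true (<-trans (<ᵇ-true⁻ {u} {y} uy) (<ᵇ-true⁻ {y} {z} yz))
  below-lower decreasing u zy with u <ᵇ z in uz
  ... | false = ∧-zeroʳ (u <ᵇ y)
  ... | true  = cong (_∧ true) (<ᵇ-true (<-trans (<ᵇ-true⁻ {u} {z} uz) (<ᵇ-true⁻ {z} {y} zy)))

  ≢-lower-upper : ∀ o {u} → u ≢ y → u ≢ z → u ≢ lower o y z × u ≢ upper o y z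
  ≢-lower-upper increasing u≢y u≢z = u≢y , u≢z
  ≢-lower-upper decreasing u≢y u≢z = u≢z , u≢y

topPair-order⁻ : ∀ o {x y z} → topPairOrder o x y z ≡ true → x < y × x < z × inOrder o y z ≡ true
topPair-order⁻ o {x} {y} {z} ord with x <ᵇ y in xy | x <ᵇ z in xz
... | true | true = <ᵇ-true⁻ {x} {y} xy , <ᵇ-true⁻ {x} {z} xz , ord

-- Columns 2 and 3 carry the same shading in R₄₆, so both tests use their zone₂ as zone₃.
agree-topPair : ∀ o σ B → (∀ x y z → orderIsoᵇ (x ∷ y ∷ z ∷ []) σ ≡ topPairOrder o x y z) →
                Agree B (Shading₄₆.test σ B) (topPairTest o)
agree-topPair o σ B orderIso-≡ = record
  { order-≡ = orderIso-≡ ; zone₁-≡ = zone₁-≡ ; zone₂-≡ = zone₂-≡ ; zone₃-≡ = zone₂-≡ }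
  where
    sorted : ∀ {x y z} c₁ c₂ c₃ u → orderIsoᵇ (x ∷ y ∷ z ∷ []) σ ≡ true →
             avoid₄₆ B x y z c₁ c₂ c₃ u ≡ avoids R₄₆ (columns c₁ c₂ c₃) (0 ∷ x ∷ lower o y z ∷ upper o y z ∷ B ∷ []) u
    sorted {x} {y} {z} c₁ c₂ c₃ u ord with (x<y , x<z , yz) ← topPair-order⁻ o (trans (sym (orderIso-≡ x y z)) ord) =
      cong (λ V → avoids R₄₆ (columns c₁ c₂ c₃) (0 ∷ V ++ [ B ]) u) (sort-topPair o x<y x<z yz)
    zone₁-≡ : ∀ {x y z u} → orderIsoᵇ (x ∷ y ∷ z ∷ []) σ ≡ true → Fresh B y z u →
              avoid₄₆ B x y z true false false u ≡ below y z u
    zone₁-≡ {x} {y} {z} {u} ord (u≢y , u≢z , u<B)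
      with (x<y , x<z , yz) ← topPair-order⁻ o (trans (sym (orderIso-≡ x y z)) ord)
      with (u≢lo , u≢hi) ← ≢-lower-upper o u≢y u≢z =
      trans (sorted true false false u ord)
            (trans (zone₁-sorted (lower<upper o yz) u≢lo u≢hi u<B) (sym (below-lower o u yz)))
    zone₂-≡ : ∀ {x y z u} → orderIsoᵇ (x ∷ y ∷ z ∷ []) σ ≡ true → Fresh B y z u →
              avoid₄₆ B x y z false true false u ≡ notAbove x u
    zone₂-≡ {x} {y} {z} {u} ord (u≢y , u≢z , u<B)
      with (x<y , x<z , yz) ← topPair-order⁻ o (trans (sym (orderIso-≡ x y z)) ord)
      with (u≢lo , u≢hi) ← ≢-lower-upper o u≢y u≢z =
      trans (sorted false true false u ord) (zone₂-sorted (lower-above o x<y x<z) (lower<upper o yz) u≢lo u≢hi u<B)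

-- Counting by the first letter

topPairLast : Order → List ℕ → List ℕ → Bool
topPairLast o E []               = false
topPairLast o E (p ∷ [])         = false
topPairLast o E (p ∷ q ∷ [])     = inOrder o p q ∧ all (below p q) E
topPairLast o E (p ∷ q ∷ r ∷ rs) = topPairLast o (E ++ [ p ]) (q ∷ r ∷ rs)

topPairCount : Order → List ℕ → ℕ
topPairCount o []      = 0
topPairCount o (x ∷ t) = boolToℕ (topPairLast o [] (filterᵇ (x <ᵇ_) t)) + topPairCount o t

pairEnd : Order → List ℕ → ℕ → List ℕ → Bool
pairEnd o E y []       = false
pairEnd o E y (z ∷ fr) = (inOrder o y z ∧ all (below y z) E) ∧ null fr

topPairLast-∷ : ∀ o E y u →
  boolToℕ (pairEnd o E y u) + boolToℕ (topPairLast o (E ++ [ y ]) u) ≡ boolToℕ (topPairLast o E (y ∷ u))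
topPairLast-∷ o E y []               = refl
topPairLast-∷ o E y (z ∷ [])         = trans (+-identityʳ _) (cong boolToℕ (∧-identityʳ _))
topPairLast-∷ o E y u@(z ∷ _ ∷ _) =
  cong (λ b → boolToℕ b + boolToℕ (topPairLast o (E ++ [ y ]) u)) (∧-zeroʳ (inOrder o y z ∧ all (below y z) E))

all-notAbove : ∀ x r → all (notAbove x) r ≡ null (filterᵇ (x <ᵇ_) r)
all-notAbove x []      = refl
all-notAbove x (u ∷ r) with x <ᵇ u
... | true  = refl
... | false = all-notAbove x r

filter-above : ∀ x s → All (x <_) (filterᵇ (x <ᵇ_) s)
filter-above x s = All.map (<ᵇ⇒< x _) (AllP.all-filter (T? ∘ (x <ᵇ_)) s)

all-below-filter : ∀ {x p q} → x < p → x < q → ∀ E → all (below p q) E ≡ all (below p q) (filterᵇ (x <ᵇ_) E)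
all-below-filter             x<p x<q []      = refl
all-below-filter {x} {p} {q} x<p x<q (e ∷ E) with x <ᵇ e in xe
... | true  = cong (below p q e ∧_) (all-below-filter x<p x<q E)
... | false = trans (cong (_∧ all (below p q) E) e-below) (all-below-filter x<p x<q E)
  where
    e-below : below p q e ≡ true
    e-below = cong₂ _∧_ (<ᵇ-true (≤-<-trans (<ᵇ-false⁻ xe) x<p)) (<ᵇ-true (≤-<-trans (<ᵇ-false⁻ xe) x<q))

module TopPair (o : Order) where
  open TripleCount (topPairTest o)
  open ∨-∧-Solver using (solve; _:=_; _:*_; con)

  singles-topPair : ∀ x y R₁ R₂ s →
    singles x y R₁ R₂ s ≡ boolToℕ ((x <ᵇ y) ∧ (all (notAbove x) R₂ ∧ pairEnd o R₁ y (filterᵇ (x <ᵇ_) s)))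
  singles-topPair x y R₁ R₂ [] =
    sym (cong boolToℕ (trans (cong ((x <ᵇ y) ∧_) (∧-zeroʳ (all (notAbove x) R₂))) (∧-zeroʳ (x <ᵇ y))))
  singles-topPair x y R₁ R₂ (z ∷ r) with x <ᵇ z in xz
  ... | false = begin
    boolToℕ ((X ∧ false) ∧ (B₁ ∧ (A₂ ∧ all (notAbove x) r))) + singles x y R₁ (R₂ ++ [ z ]) r
      ≡⟨ cong₂ _+_ (cong boolToℕ (solve 2 (λ X Y → (X :* con false) :* Y := con false) refl X _))
                   (singles-topPair x y R₁ (R₂ ++ [ z ]) r) ⟩
    boolToℕ (X ∧ (all (notAbove x) (R₂ ++ [ z ]) ∧ pe))
      ≡⟨ cong (λ b → boolToℕ (X ∧ b)) (trans (all-∷ʳ-∧ (notAbove x) R₂ z pe) (cong (λ b → A₂ ∧ (not b ∧ pe)) xz)) ⟩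
    boolToℕ (X ∧ (A₂ ∧ pe)) ∎
    where
      open ≡-Reasoning
      X A₂ B₁ pe : Bool
      X = x <ᵇ y ; A₂ = all (notAbove x) R₂ ; B₁ = all (below y z) R₁ ; pe = pairEnd o R₁ y (filterᵇ (x <ᵇ_) r)
  ... | true = begin
    boolToℕ ((X ∧ ρ) ∧ (B₁ ∧ (A₂ ∧ all (notAbove x) r))) + singles x y R₁ (R₂ ++ [ z ]) r
      ≡⟨ cong₂ _+_ (cong (λ b → boolToℕ ((X ∧ ρ) ∧ (B₁ ∧ (A₂ ∧ b)))) (all-notAbove x r))
                   (trans (singles-topPair x y R₁ (R₂ ++ [ z ]) r) none-later) ⟩
    boolToℕ ((X ∧ ρ) ∧ (B₁ ∧ (A₂ ∧ null fr))) + 0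
      ≡⟨ +-identityʳ _ ⟩
    boolToℕ ((X ∧ ρ) ∧ (B₁ ∧ (A₂ ∧ null fr)))
      ≡⟨ cong boolToℕ (solve 5 (λ X ρ B A N → (X :* ρ) :* (B :* (A :* N)) := X :* (A :* ((ρ :* B) :* N)))
                              refl X ρ B₁ A₂ (null fr)) ⟩
    boolToℕ (X ∧ (A₂ ∧ ((ρ ∧ B₁) ∧ null fr))) ∎
    where
      open ≡-Reasoning
      X A₂ ρ B₁ : Bool
      X = x <ᵇ y ; A₂ = all (notAbove x) R₂ ; ρ = inOrder o y z ; B₁ = all (below y z) R₁
      fr : List ℕ
      fr = filterᵇ (x <ᵇ_) r
      none-later : boolToℕ (X ∧ (all (notAbove x) (R₂ ++ [ z ]) ∧ pairEnd o R₁ y fr)) ≡ 0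
      none-later =
        cong boolToℕ (trans (cong (X ∧_) (trans (all-∷ʳ-∧ (notAbove x) R₂ z (pairEnd o R₁ y fr))
                                                (trans (cong (λ b → A₂ ∧ (not b ∧ pairEnd o R₁ y fr)) xz)
                                                       (∧-zeroʳ A₂))))
                            (∧-zeroʳ X))

  pairEnd-filter : ∀ {x y} R₁ fs → x < y → All (x <_) fs → pairEnd o R₁ y fs ≡ pairEnd o (filterᵇ (x <ᵇ_) R₁) y fs
  pairEnd-filter R₁ []       x<y _         = refl
  pairEnd-filter R₁ (z ∷ fr) x<y (x<z ∷ _) = cong (λ b → (inOrder o _ z ∧ b) ∧ null fr) (all-below-filter x<y x<z R₁)

  pairs-topPair : ∀ x R₁ t → pairs x R₁ t ≡ boolToℕ (topPairLast o (filterᵇ (x <ᵇ_) R₁) (filterᵇ (x <ᵇ_) t))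
  pairs-topPair x R₁ []      = refl
  pairs-topPair x R₁ (y ∷ s) with x <ᵇ y in xy
  ... | false = begin
    singles x y R₁ [] s + pairs x (R₁ ++ [ y ]) s
      ≡⟨ cong₂ _+_ (singles-topPair x y R₁ [] s) (pairs-topPair x (R₁ ++ [ y ]) s) ⟩
    boolToℕ ((x <ᵇ y) ∧ pairEnd o R₁ y fs) + boolToℕ (topPairLast o (filterᵇ (x <ᵇ_) (R₁ ++ [ y ])) fs)
      ≡⟨ cong₂ (λ b E → boolToℕ (b ∧ pairEnd o R₁ y fs) + boolToℕ (topPairLast o E fs)) xy (filter-∷ʳ (x <ᵇ_) R₁ y) ⟩
    boolToℕ (topPairLast o (filterᵇ (x <ᵇ_) R₁ ++ (if x <ᵇ y then [ y ] else [])) fs)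
      ≡⟨ cong (λ b → boolToℕ (topPairLast o (filterᵇ (x <ᵇ_) R₁ ++ (if b then [ y ] else [])) fs)) xy ⟩
    boolToℕ (topPairLast o (filterᵇ (x <ᵇ_) R₁ ++ []) fs)
      ≡⟨ cong (λ E → boolToℕ (topPairLast o E fs)) (++-identityʳ (filterᵇ (x <ᵇ_) R₁)) ⟩
    boolToℕ (topPairLast o (filterᵇ (x <ᵇ_) R₁) fs) ∎
    where
      open ≡-Reasoning
      fs : List ℕ
      fs = filterᵇ (x <ᵇ_) s
  ... | true = begin
    singles x y R₁ [] s + pairs x (R₁ ++ [ y ]) s
      ≡⟨ cong₂ _+_ (singles-topPair x y R₁ [] s) (pairs-topPair x (R₁ ++ [ y ]) s) ⟩
    boolToℕ ((x <ᵇ y) ∧ pairEnd o R₁ y fs) + boolToℕ (topPairLast o (filterᵇ (x <ᵇ_) (R₁ ++ [ y ])) fs)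
      ≡⟨ cong₂ (λ b E → boolToℕ (b ∧ pairEnd o R₁ y fs) + boolToℕ (topPairLast o E fs)) xy (filter-∷ʳ (x <ᵇ_) R₁ y) ⟩
    boolToℕ (pairEnd o R₁ y fs) + boolToℕ (topPairLast o (filterᵇ (x <ᵇ_) R₁ ++ (if x <ᵇ y then [ y ] else [])) fs)
      ≡⟨ cong₂ (λ p b → boolToℕ p + boolToℕ (topPairLast o (filterᵇ (x <ᵇ_) R₁ ++ (if b then [ y ] else [])) fs))
               (pairEnd-filter R₁ fs (<ᵇ-true⁻ {x} {y} xy) (filter-above x s)) xy ⟩
    boolToℕ (pairEnd o (filterᵇ (x <ᵇ_) R₁) y fs) + boolToℕ (topPairLast o (filterᵇ (x <ᵇ_) R₁ ++ [ y ]) fs)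
      ≡⟨ topPairLast-∷ o (filterᵇ (x <ᵇ_) R₁) y fs ⟩
    boolToℕ (topPairLast o (filterᵇ (x <ᵇ_) R₁) (y ∷ fs)) ∎
    where
      open ≡-Reasoning
      fs : List ℕ
      fs = filterᵇ (x <ᵇ_) s

  triples-topPair : ∀ w → triples w ≡ topPairCount o w
  triples-topPair []      = refl
  triples-topPair (x ∷ t) = cong₂ _+_ (pairs-topPair x [] t) (triples-topPair t)

-- The exchange involution

module Exchange {A : Set} (key : A → ℕ) where

  above : A → List A → ℕ
  above x t = length (filterᵇ (λ v → key x <ᵇ key v) t)

  maxOf : A → List A → A
  maxOf y []      = y
  maxOf y (z ∷ r) = maxOf (if key y <ᵇ key z then z else y) r

  replace : A → A → List A → List A
  replace M x = map (λ v → if key v ≡ᵇ key M then x else v)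

  exchange : List A → List A
  exchange []          = []
  exchange (x ∷ [])    = x ∷ []
  exchange (x ∷ y ∷ s) =
    if above x (y ∷ s) <ᵇ 2
    then maxOf y s ∷ replace (maxOf y s) x (exchange (y ∷ s))
    else x ∷ exchange (y ∷ s)

  maxOf-∈ : ∀ y s → maxOf y s ∈ y ∷ s
  maxOf-∈ y []      = here refl
  maxOf-∈ y (z ∷ r) with key y <ᵇ key z
  ... | true  = there (maxOf-∈ z r)
  ... | false with maxOf-∈ y r
  ...   | here eq   = here eq
  ...   | there m∈r = there (there m∈r)

  replace-∈ : ∀ M x L {v} → v ∈ replace M x L → v ≡ x ⊎ v ∈ L
  replace-∈ M x (u ∷ L) (here eq) with key u ≡ᵇ key M
  ... | true  = inj₁ eq
  ... | false = inj₂ (here eq)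
  replace-∈ M x (u ∷ L) (there v∈) = Sum.map₂ there (replace-∈ M x L v∈)

  exchange-⊆ : ∀ l {v} → v ∈ exchange l → v ∈ l
  exchange-⊆ (x ∷ [])      v∈ = v∈
  exchange-⊆ (x ∷ t@(y ∷ s))  = from (above x t <ᵇ 2) (exchange-⊆ t)
    where
      from : ∀ b → (∀ {v} → v ∈ exchange t → v ∈ t) → ∀ {v} →
             v ∈ (if b then maxOf y s ∷ replace (maxOf y s) x (exchange t) else x ∷ exchange t) → v ∈ x ∷ t
      from true  ⊆t (here refl) = there (maxOf-∈ y s)
      from true  ⊆t (there v∈)  =
        Sum.[ (λ { refl → here refl }) , there ∘ ⊆t ] (replace-∈ (maxOf y s) x (exchange t) v∈)
      from false ⊆t (here refl) = here refl
      from false ⊆t (there v∈)  = there (⊆t v∈)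

  exchange-length : ∀ l → length (exchange l) ≡ length l
  exchange-length []              = refl
  exchange-length (x ∷ [])        = refl
  exchange-length (x ∷ t@(y ∷ s)) = from (above x t <ᵇ 2) (exchange-length t)
    where
      from : ∀ b → length (exchange t) ≡ length t →
             length (if b then maxOf y s ∷ replace (maxOf y s) x (exchange t) else x ∷ exchange t) ≡ length (x ∷ t)
      from true  ih = cong suc (trans (length-map _ (exchange t)) ih)
      from false ih = cong suc ih

module _ {A B : Set} (κ : A → ℕ) (κ′ : B → ℕ) (f : A → B) where
  private
    module EA = Exchange κ
    module EB = Exchange κ′

  StrictlyMonotoneOn : List A → Set
  StrictlyMonotoneOn l = ∀ {a b} → a ∈ l → b ∈ l → (κ′ (f a) <ᵇ κ′ (f b)) ≡ (κ a <ᵇ κ b)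

  private
    injectiveOn : ∀ {l} → StrictlyMonotoneOn l → ∀ {a b} → a ∈ l → b ∈ l → (κ′ (f a) ≡ᵇ κ′ (f b)) ≡ (κ a ≡ᵇ κ b)
    injectiveOn mono {a} {b} a∈ b∈ =
      trans (≡ᵇ-via-<ᵇ (κ′ (f a)) (κ′ (f b)))
            (trans (cong₂ (λ p q → not p ∧ not q) (mono a∈ b∈) (mono b∈ a∈)) (sym (≡ᵇ-via-<ᵇ (κ a) (κ b))))

    above-map : ∀ x t → StrictlyMonotoneOn (x ∷ t) → EB.above (f x) (map f t) ≡ EA.above x t
    above-map x t mono = trans (count-map _ f t) (count-cong (All.tabulate (λ v∈ → mono (here refl) (there v∈))))

    maxOf-map : ∀ y s → StrictlyMonotoneOn (y ∷ s) → EB.maxOf (f y) (map f s) ≡ f (EA.maxOf y s)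
    maxOf-map y []      mono = refl
    maxOf-map y (z ∷ r) mono = begin
      EB.maxOf (if κ′ (f y) <ᵇ κ′ (f z) then f z else f y) (map f r)
        ≡⟨ cong (λ b → EB.maxOf (if b then f z else f y) (map f r)) (mono (here refl) (there (here refl))) ⟩
      EB.maxOf (if κ y <ᵇ κ z then f z else f y) (map f r)
        ≡⟨ cong (λ v → EB.maxOf v (map f r)) (sym (if-map f (κ y <ᵇ κ z) z y)) ⟩
      EB.maxOf (f m) (map f r)
        ≡⟨ maxOf-map m r (λ a∈ b∈ → mono (shrink a∈) (shrink b∈)) ⟩
      f (EA.maxOf m r) ∎
      where
        open ≡-Reasoning
        m : A
        m = if κ y <ᵇ κ z then z else y
        m∈ : ∀ b → (if b then z else y) ∈ y ∷ z ∷ r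
        m∈ true  = there (here refl)
        m∈ false = here refl
        shrink : ∀ {a} → a ∈ m ∷ r → a ∈ y ∷ z ∷ r
        shrink (here refl) = m∈ (κ y <ᵇ κ z)
        shrink (there a∈)  = there (there a∈)

    replace-map : ∀ M x L → (∀ {v} → v ∈ L → (κ′ (f v) ≡ᵇ κ′ (f M)) ≡ (κ v ≡ᵇ κ M)) →
                  EB.replace (f M) (f x) (map f L) ≡ map f (EA.replace M x L)
    replace-map M x []      eq = refl
    replace-map M x (v ∷ L) eq =
      cong₂ _∷_ (trans (cong (λ b → if b then f x else f v) (eq (here refl))) (sym (if-map f (κ v ≡ᵇ κ M) x v)))
                (replace-map M x L (eq ∘ there))

  exchange-map : ∀ l → StrictlyMonotoneOn l → EB.exchange (map f l) ≡ map f (EA.exchange l)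
  exchange-map []              mono = refl
  exchange-map (x ∷ [])        mono = refl
  exchange-map (x ∷ t@(y ∷ s)) mono = begin
    (if EB.above (f x) (map f t) <ᵇ 2
     then EB.maxOf (f y) (map f s) ∷ EB.replace (EB.maxOf (f y) (map f s)) (f x) (EB.exchange (map f t))
     else f x ∷ EB.exchange (map f t))
      ≡⟨ cong₂ (λ a m → if a <ᵇ 2 then m ∷ EB.replace m (f x) (EB.exchange (map f t)) else f x ∷ EB.exchange (map f t))
               (above-map x t mono) (maxOf-map y s (λ a∈ b∈ → mono (there a∈) (there b∈))) ⟩
    (if EA.above x t <ᵇ 2 then f M ∷ EB.replace (f M) (f x) (EB.exchange (map f t)) else f x ∷ EB.exchange (map f t))
      ≡⟨ cong (λ L → if EA.above x t <ᵇ 2 then f M ∷ EB.replace (f M) (f x) L else f x ∷ L)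
              (exchange-map t (λ a∈ b∈ → mono (there a∈) (there b∈))) ⟩
    (if EA.above x t <ᵇ 2 then f M ∷ EB.replace (f M) (f x) (map f (EA.exchange t)) else f x ∷ map f (EA.exchange t))
      ≡⟨ cong (λ L → if EA.above x t <ᵇ 2 then f M ∷ L else f x ∷ map f (EA.exchange t))
              (replace-map M x (EA.exchange t)
                           (λ v∈ → injectiveOn mono (there (EA.exchange-⊆ t v∈)) (there (EA.maxOf-∈ y s)))) ⟩
    (if EA.above x t <ᵇ 2 then f M ∷ map f (EA.replace M x (EA.exchange t)) else f x ∷ map f (EA.exchange t))
      ≡⟨ if-map (map f) (EA.above x t <ᵇ 2) (M ∷ EA.replace M x (EA.exchange t)) (x ∷ EA.exchange t) ⟨
    map f (EA.exchange (x ∷ t)) ∎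
    where
      open ≡-Reasoning
      M : A
      M = EA.maxOf y s

open Exchange {ℕ} id

IsMax : ℕ → List ℕ → Set
IsMax m t = m ∈ t × All (_≤ m) t

maxOf-≥ : ∀ y s → All (_≤ maxOf y s) (y ∷ s)
maxOf-≥ y []      = ≤-refl ∷ []
maxOf-≥ y (z ∷ r) with y <ᵇ z in yz | maxOf-≥ (if y <ᵇ z then z else y) r
... | true  | z≤M ∷ r≤M = ≤-trans (<⇒≤ (<ᵇ-true⁻ {y} {z} yz)) z≤M ∷ z≤M ∷ r≤M
... | false | y≤M ∷ r≤M = y≤M ∷ ≤-trans (<ᵇ-false⁻ yz) y≤M ∷ r≤M

maxOf-isMax : ∀ y s → IsMax (maxOf y s) (y ∷ s)
maxOf-isMax y s = maxOf-∈ y s , maxOf-≥ y s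

isMax-unique : ∀ {m m′ t} → IsMax m t → IsMax m′ t → m ≡ m′
isMax-unique (m∈ , ≤m) (m′∈ , ≤m′) = ≤-antisym (All.lookup ≤m′ m∈) (All.lookup ≤m m′∈)

exchange-keep : ∀ x t → 2 ≤ above x t → exchange (x ∷ t) ≡ x ∷ exchange t
exchange-keep x t@(_ ∷ _) 2≤above with above x t <ᵇ 2 | <ᵇ-false {above x t} {2} 2≤above
... | _ | refl = refl

exchange-swap : ∀ x t {M} → above x t ≤ 1 → IsMax M t → exchange (x ∷ t) ≡ M ∷ replace M x (exchange t)
exchange-swap x t@(y ∷ s) above≤1 isMax with above x t <ᵇ 2 | <ᵇ-true {above x t} {2} (s≤s above≤1)
... | _ | refl = cong (λ m → m ∷ replace m x (exchange t)) (isMax-unique (maxOf-isMax y s) isMax)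

swapIn : ℕ → ℕ → ℕ → ℕ
swapIn M x v = if v ≡ᵇ M then x else v

replace-∉ : ∀ M x t → All (M ≢_) t → replace M x t ≡ t
replace-∉ M x []      []           = refl
replace-∉ M x (v ∷ t) (M≢v ∷ M∉t) = cong₂ _∷_ (cong (if_then x else v) (≡ᵇ-false (M≢v ∘ sym))) (replace-∉ M x t M∉t)

replace-↭ : ∀ M x t → Unique t → M ∈ t → M ∷ replace M x t ↭ x ∷ t
replace-↭ M x (v ∷ t) (v∉t ∷ _) (here refl) rewrite ≡ᵇ-refl v | replace-∉ v x t v∉t = ↭-swap v x ↭-refl
replace-↭ M x (v ∷ t) (v∉t ∷ U) (there M∈t) rewrite ≡ᵇ-false {v} {M} (All.lookup v∉t M∈t) =
  ↭-trans (↭-swap M v ↭-refl) (↭-trans (↭-prep v (replace-↭ M x t U M∈t)) (↭-swap v x ↭-refl))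

replace-replace : ∀ M x L → All (x ≢_) L → replace x M (replace M x L) ≡ L
replace-replace M x []      []            = refl
replace-replace M x (v ∷ L) (x≢v ∷ x∉L) with v ≡ᵇ M in vM
... | true  rewrite ≡ᵇ-refl x = cong₂ _∷_ (sym (≡ᵇ-true⁻ {v} {M} vM)) (replace-replace M x L x∉L)
... | false rewrite ≡ᵇ-false {v} {x} (x≢v ∘ sym) = cong (v ∷_) (replace-replace M x L x∉L)

exchange-↭ : ∀ l → Unique l → exchange l ↭ l
exchange-↭ []              _       = ↭-refl
exchange-↭ (x ∷ [])        _       = ↭-refl
exchange-↭ (x ∷ t@(y ∷ s)) (_ ∷ U) with ≤-<-connex (above x t) 1
... | inj₂ 2≤above rewrite exchange-keep x t 2≤above = ↭-prep x (exchange-↭ t U)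
... | inj₁ above≤1 rewrite exchange-swap x t above≤1 (maxOf-isMax y s) =
  ↭-trans (↭-prep (maxOf y s) (PermP.map⁺ _ (exchange-↭ t U))) (replace-↭ (maxOf y s) x t U (maxOf-∈ y s))

Unique-exchange : ∀ l → Unique l → Unique (exchange l)
Unique-exchange l U = Unique-↭ (↭-sym (exchange-↭ l U)) U

filter-none : ∀ {x} L → All (_≤ x) L → filterᵇ (x <ᵇ_) L ≡ []
filter-none     []      []            = refl
filter-none {x} (v ∷ L) (v≤x ∷ L≤x) with x <ᵇ v | <ᵇ-false {x} {v} v≤x
... | _ | refl = filter-none L L≤x

filter-accept : ∀ {x y} L → x < y → filterᵇ (x <ᵇ_) (y ∷ L) ≡ y ∷ filterᵇ (x <ᵇ_) L
filter-accept {x} {y} L x<y with x <ᵇ y | <ᵇ-true x<y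
... | _ | refl = refl

filter-reject : ∀ {x y} L → y ≤ x → filterᵇ (x <ᵇ_) (y ∷ L) ≡ filterᵇ (x <ᵇ_) L
filter-reject {x} {y} L y≤x with x <ᵇ y | <ᵇ-false {x} {y} y≤x
... | _ | refl = refl

above-∈ : ∀ x t {a} → a ∈ t → x < a → 1 ≤ above x t
above-∈ x (v ∷ t) (here refl) x<v rewrite filter-accept t x<v = s≤s z≤n
above-∈ x (v ∷ t) (there a∈t) x<a with x <ᵇ v
... | true  = s≤s z≤n
... | false = above-∈ x t a∈t x<a

above-two : ∀ x t {a b} → a ∈ t → b ∈ t → a ≢ b → x < a → x < b → 2 ≤ above x t
above-two x (v ∷ t) (here refl) (here refl) a≢b _   _   = ⊥-elim (a≢b refl)
above-two x (v ∷ t) (here refl) (there b∈t) _   x<v x<b rewrite filter-accept t x<v = s≤s (above-∈ x t b∈t x<b)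
above-two x (v ∷ t) (there a∈t) (here refl) _   x<a x<v rewrite filter-accept t x<v = s≤s (above-∈ x t a∈t x<a)
above-two x (v ∷ t) (there a∈t) (there b∈t) a≢b x<a x<b with x <ᵇ v
... | true  = ≤-trans (above-two x t a∈t b∈t a≢b x<a x<b) (n≤1+n _)
... | false = above-two x t a∈t b∈t a≢b x<a x<b

above-∷ : ∀ e a u → above e u ≤ above e (a ∷ u)
above-∷ e a u with e <ᵇ a
... | true  = n≤1+n _
... | false = ≤-refl

above-filter : ∀ {x y} s → x < y → above y (filterᵇ (x <ᵇ_) s) ≡ above y s
above-filter         []      x<y = refl
above-filter {x} {y} (v ∷ s) x<y with x <ᵇ v in xv
... | true  = trans (count-∷ (y <ᵇ_) v (filterᵇ (x <ᵇ_) s))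
                    (trans (cong (boolToℕ (y <ᵇ v) +_) (above-filter s x<y)) (sym (count-∷ (y <ᵇ_) v s)))
... | false with y <ᵇ v | <ᵇ-false {y} {v} (≤-trans (<ᵇ-false⁻ {x} {v} xv) (<⇒≤ x<y))
...   | _ | refl = above-filter s x<y

top-rest : ∀ {x t M} → All (x ≢_) t → above x t ≤ 1 → IsMax M t → ∀ {v} → v ∈ t → v ≢ M → v < x
top-rest {x} {t} x∉t above≤1 (M∈t , ≤M) {v} v∈t v≢M with <-cmp v x
... | tri< v<x _ _  = v<x
... | tri≈ _ refl _ = ⊥-elim (All.lookup x∉t v∈t refl)
... | tri> _ _ x<v  =
  ⊥-elim (1+n≰n (≤-trans (above-two x t v∈t M∈t v≢M x<v (<-≤-trans x<v (All.lookup ≤M v∈t))) above≤1))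

replace-monotone : ∀ {x t M} → All (x ≢_) t → above x t ≤ 1 → IsMax M t → StrictlyMonotoneOn id id (swapIn M x) t
replace-monotone {x} {t} {M} x∉t above≤1 isMax@(_ , ≤M) {a} {b} a∈t b∈t with a ≡ᵇ M in aM | b ≡ᵇ M in bM
... | true  | true  rewrite ≡ᵇ-true⁻ {a} {M} aM | ≡ᵇ-true⁻ {b} {M} bM = trans (<ᵇ-irrefl x) (sym (<ᵇ-irrefl M))
... | true  | false rewrite ≡ᵇ-true⁻ {a} {M} aM =
  trans (<ᵇ-false (<⇒≤ (top-rest x∉t above≤1 isMax b∈t (≡ᵇ-false⁻ bM)))) (sym (<ᵇ-false (All.lookup ≤M b∈t)))
... | false | true  rewrite ≡ᵇ-true⁻ {b} {M} bM =
  trans (<ᵇ-true (top-rest x∉t above≤1 isMax a∈t (≡ᵇ-false⁻ aM)))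
        (sym (<ᵇ-true (≤∧≢⇒< (All.lookup ≤M a∈t) (≡ᵇ-false⁻ aM))))
... | false | false = refl

above-replace : ∀ M x L → Unique L → All (_≤ M) L → above M (replace M x L) ≤ 1
above-replace M x []      _           _           = z≤n
above-replace M x (v ∷ L) (v∉L ∷ U) (v≤M ∷ L≤M) with v ≡ᵇ M in vM
... | true = subst (_≤ 1) (sym count) (subst (_≤ 1) (sym (+-identityʳ _)) (boolToℕ≤1 (M <ᵇ x)))
  where
    M∉L : All (M ≢_) L
    M∉L = subst (λ m → All (m ≢_) L) (≡ᵇ-true⁻ {v} {M} vM) v∉L
    count : above M (x ∷ replace M x L) ≡ boolToℕ (M <ᵇ x) + 0
    count = trans (count-∷ (M <ᵇ_) x (replace M x L))
                  (cong (λ K → boolToℕ (M <ᵇ x) + length K)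
                        (trans (cong (filterᵇ (M <ᵇ_)) (replace-∉ M x L M∉L)) (filter-none L L≤M)))
... | false with M <ᵇ v | <ᵇ-false {M} {v} v≤M
...   | _ | refl = above-replace M x L U L≤M

replace-isMax : ∀ {x t M} → All (x ≢_) t → above x t ≤ 1 → IsMax M t → ∀ {L} → L ↭ t → IsMax x (replace M x L)
replace-isMax {x} {t} {M} x∉t above≤1 isMax@(M∈t , _) {L} L↭t =
  x∈ L (PermP.∈-resp-↭ (↭-sym L↭t) M∈t) , AllP.map⁺ (All.tabulate swapIn≤x)
  where
    x∈ : ∀ L → M ∈ L → x ∈ replace M x L
    x∈ (v ∷ L) (here refl) rewrite ≡ᵇ-refl v = here refl
    x∈ (v ∷ L) (there M∈L) = there (x∈ L M∈L)
    swapIn≤x : ∀ {v} → v ∈ L → swapIn M x v ≤ x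
    swapIn≤x {v} v∈L with v ≡ᵇ M in vM
    ... | true  = ≤-refl
    ... | false = <⇒≤ (top-rest x∉t above≤1 isMax (PermP.∈-resp-↭ L↭t v∈L) (≡ᵇ-false⁻ vM))

exchange-top : ∀ x t {M} → Unique t → IsMax M t → above M (replace M x (exchange t)) ≤ 1
exchange-top x t {M} Ut isMax =
  above-replace M x (exchange t) (Unique-exchange t Ut) (PermP.All-resp-↭ (↭-sym (exchange-↭ t Ut)) (proj₂ isMax))

exchange-monotone : ∀ {x t M} → All (x ≢_) t → above x t ≤ 1 → IsMax M t →
                    StrictlyMonotoneOn id id (swapIn M x) (exchange t)
exchange-monotone {t = t} x∉t above≤1 isMax a∈ b∈ =
  replace-monotone x∉t above≤1 isMax (exchange-⊆ t a∈) (exchange-⊆ t b∈)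

exchange-involutive : ∀ l → Unique l → exchange (exchange l) ≡ l
exchange-involutive []              _           = refl
exchange-involutive (x ∷ [])        _           = refl
exchange-involutive (x ∷ t@(y ∷ s)) (x∉t ∷ Ut) with ≤-<-connex (above x t) 1
... | inj₂ 2≤above = begin
  exchange (exchange (x ∷ t))
    ≡⟨ cong exchange (exchange-keep x t 2≤above) ⟩
  exchange (x ∷ exchange t)
    ≡⟨ exchange-keep x (exchange t) (subst (2 ≤_) (count-↭ (x <ᵇ_) (↭-sym (exchange-↭ t Ut))) 2≤above) ⟩
  x ∷ exchange (exchange t)
    ≡⟨ cong (x ∷_) (exchange-involutive t Ut) ⟩
  x ∷ t ∎
  where open ≡-Reasoning
... | inj₁ above≤1 = begin
  exchange (exchange (x ∷ t))
    ≡⟨ cong exchange (exchange-swap x t above≤1 isMax) ⟩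
  exchange (M ∷ replace M x (exchange t))
    ≡⟨ exchange-swap M _ (exchange-top x t Ut isMax) (replace-isMax x∉t above≤1 isMax (exchange-↭ t Ut)) ⟩
  x ∷ replace x M (exchange (replace M x (exchange t)))
    ≡⟨ cong (λ K → x ∷ replace x M K)
            (exchange-map id id (swapIn M x) (exchange t) (exchange-monotone x∉t above≤1 isMax)) ⟩
  x ∷ replace x M (replace M x (exchange (exchange t)))
    ≡⟨ cong (λ K → x ∷ replace x M (replace M x K)) (exchange-involutive t Ut) ⟩
  x ∷ replace x M (replace M x t)
    ≡⟨ cong (x ∷_) (replace-replace M x t x∉t) ⟩
  x ∷ t ∎
  where
    open ≡-Reasoning
    M : ℕ
    M = maxOf y s
    isMax : IsMax M t
    isMax = maxOf-isMax y s

filter-replace : ∀ {x} M y L → (x <ᵇ M) ≡ (x <ᵇ y) → filterᵇ (x <ᵇ_) (replace M y L) ≡ replace M y (filterᵇ (x <ᵇ_) L)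
filter-replace {x} M y L same =
  trans (filter-map (x <ᵇ_) (swapIn M y) L) (cong (replace M y) (filter-cong (All.universal unmoved L)))
  where
    unmoved : ∀ v → (x <ᵇ swapIn M y v) ≡ (x <ᵇ v)
    unmoved v with v ≡ᵇ M in vM
    ... | true  = trans (sym same) (cong (x <ᵇ_) (sym (≡ᵇ-true⁻ {v} {M} vM)))
    ... | false = refl

filter-replace-max : ∀ {x y M} L → Unique L → M ∈ L → All (_≤ x) L → x < y → filterᵇ (x <ᵇ_) (replace M y L) ≡ [ y ]
filter-replace-max {x} {y} (v ∷ L) (v∉L ∷ _) (here refl) (_ ∷ L≤x) x<y with v ≡ᵇ v | ≡ᵇ-refl v
... | _ | refl rewrite filter-accept (replace v y L) x<y | replace-∉ v y L v∉L | filter-none L L≤x = refl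
filter-replace-max {x} {y} {M} (v ∷ L) (v∉L ∷ U) (there M∈L) (v≤x ∷ L≤x) x<y
  with v ≡ᵇ M | ≡ᵇ-false {v} {M} (All.lookup v∉L M∈L)
... | _ | refl rewrite filter-reject (replace M y L) v≤x = filter-replace-max L U M∈L L≤x x<y

filter-single : ∀ {x M} s → Unique s → M ∈ s → x < M → (∀ {v} → v ∈ s → v ≢ M → v ≤ x) → filterᵇ (x <ᵇ_) s ≡ [ M ]
filter-single {x} (v ∷ s) (v∉s ∷ _) (here refl) x<v rest rewrite filter-accept s x<v =
  cong (v ∷_) (filter-none s (All.tabulate (λ u∈s → rest (there u∈s) (λ u≡v → All.lookup v∉s u∈s (sym u≡v)))))
filter-single {x} {M} (v ∷ s) (v∉s ∷ U) (there M∈s) x<M rest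
  rewrite filter-reject s (rest (here refl) (All.lookup v∉s M∈s)) = filter-single s U M∈s x<M (rest ∘ there)

isMax-filter : ∀ {x M} s → x < M → IsMax M s → IsMax M (filterᵇ (x <ᵇ_) s)
isMax-filter {x} s x<M (M∈s , ≤M) = ∈-filter⁺ (T? ∘ (x <ᵇ_)) M∈s (<⇒<ᵇ x<M) , AllP.filter⁺ (T? ∘ (x <ᵇ_)) ≤M

module _ {x y M : ℕ} (t : List ℕ) (x∉t : All (x ≢_) t) (y∉t : All (y ≢_) t) (Ut : Unique t)
         (above≤1 : above y t ≤ 1) (isMax : IsMax M t) where

  private
    rest≤y : All (_≤ y) (replace M y (exchange t))
    rest≤y = proj₂ (replace-isMax y∉t above≤1 isMax (exchange-↭ t Ut))
    x≢M : x ≢ M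
    x≢M = All.lookup x∉t (proj₁ isMax)
    t≤x : M < x → All (_≤ x) t
    t≤x M<x = All.map (λ v≤M → <⇒≤ (≤-<-trans v≤M M<x)) (proj₂ isMax)

  filter-exchange-swap-above : x < y → filterᵇ (x <ᵇ_) (exchange t) ≡ exchange (filterᵇ (x <ᵇ_) t) →
                               filterᵇ (x <ᵇ_) (M ∷ replace M y (exchange t)) ≡ exchange (filterᵇ (x <ᵇ_) (y ∷ t))
  filter-exchange-swap-above x<y ih with <-cmp x M
  ... | tri≈ _ x≡M _ = ⊥-elim (x≢M x≡M)
  ... | tri< x<M _ _ = begin
    filterᵇ (x <ᵇ_) (M ∷ replace M y (exchange t))
      ≡⟨ filter-accept _ x<M ⟩
    M ∷ filterᵇ (x <ᵇ_) (replace M y (exchange t))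
      ≡⟨ cong (M ∷_) (filter-replace M y (exchange t) (trans (<ᵇ-true x<M) (sym (<ᵇ-true x<y)))) ⟩
    M ∷ replace M y (filterᵇ (x <ᵇ_) (exchange t))
      ≡⟨ cong (λ L → M ∷ replace M y L) ih ⟩
    M ∷ replace M y (exchange (filterᵇ (x <ᵇ_) t))
      ≡⟨ exchange-swap y (filterᵇ (x <ᵇ_) t) (subst (_≤ 1) (sym (above-filter t x<y)) above≤1)
                                               (isMax-filter t x<M isMax) ⟨
    exchange (y ∷ filterᵇ (x <ᵇ_) t)
      ≡⟨ cong exchange (filter-accept t x<y) ⟨
    exchange (filterᵇ (x <ᵇ_) (y ∷ t)) ∎
    where open ≡-Reasoning
  ... | tri> _ _ M<x = begin
    filterᵇ (x <ᵇ_) (M ∷ replace M y (exchange t))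
      ≡⟨ filter-reject _ (<⇒≤ M<x) ⟩
    filterᵇ (x <ᵇ_) (replace M y (exchange t))
      ≡⟨ filter-replace-max (exchange t) (Unique-exchange t Ut) (PermP.∈-resp-↭ (↭-sym (exchange-↭ t Ut)) (proj₁ isMax))
                            (PermP.All-resp-↭ (↭-sym (exchange-↭ t Ut)) (t≤x M<x)) x<y ⟩
    y ∷ []
      ≡⟨ cong (λ L → exchange (y ∷ L)) (filter-none t (t≤x M<x)) ⟨
    exchange (y ∷ filterᵇ (x <ᵇ_) t)
      ≡⟨ cong exchange (filter-accept t x<y) ⟨
    exchange (filterᵇ (x <ᵇ_) (y ∷ t)) ∎
    where open ≡-Reasoning

  filter-exchange-swap-below : y < x →
                               filterᵇ (x <ᵇ_) (M ∷ replace M y (exchange t)) ≡ exchange (filterᵇ (x <ᵇ_) (y ∷ t))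
  filter-exchange-swap-below y<x with <-cmp x M
  ... | tri≈ _ x≡M _ = ⊥-elim (x≢M x≡M)
  ... | tri< x<M _ _ = begin
    filterᵇ (x <ᵇ_) (M ∷ replace M y (exchange t))
      ≡⟨ filter-accept _ x<M ⟩
    M ∷ filterᵇ (x <ᵇ_) (replace M y (exchange t))
      ≡⟨ cong (M ∷_) (filter-none _ (All.map (λ v≤y → ≤-trans v≤y (<⇒≤ y<x)) rest≤y)) ⟩
    M ∷ []
      ≡⟨ cong exchange (filter-single t Ut (proj₁ isMax) x<M
                          (λ v∈ v≢M → <⇒≤ (<-trans (top-rest y∉t above≤1 isMax v∈ v≢M) y<x))) ⟨
    exchange (filterᵇ (x <ᵇ_) t)
      ≡⟨ cong exchange (filter-reject t (<⇒≤ y<x)) ⟨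
    exchange (filterᵇ (x <ᵇ_) (y ∷ t)) ∎
    where open ≡-Reasoning
  ... | tri> _ _ M<x = begin
    filterᵇ (x <ᵇ_) (M ∷ replace M y (exchange t))
      ≡⟨ filter-reject _ (<⇒≤ M<x) ⟩
    filterᵇ (x <ᵇ_) (replace M y (exchange t))
      ≡⟨ filter-none _ (All.map (λ v≤y → ≤-trans v≤y (<⇒≤ y<x)) rest≤y) ⟩
    []
      ≡⟨ cong exchange (filter-none t (t≤x M<x)) ⟨
    exchange (filterᵇ (x <ᵇ_) t)
      ≡⟨ cong exchange (filter-reject t (<⇒≤ y<x)) ⟨
    exchange (filterᵇ (x <ᵇ_) (y ∷ t)) ∎
    where open ≡-Reasoning

filter-exchange : ∀ {x} t → All (x ≢_) t → Unique t → filterᵇ (x <ᵇ_) (exchange t) ≡ exchange (filterᵇ (x <ᵇ_) t)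
filter-exchange     []              _ _ = refl
filter-exchange {x} (y ∷ [])        _ _ with x <ᵇ y
... | true  = refl
... | false = refl
filter-exchange {x} (y ∷ t@(z ∷ s)) (x≢y ∷ x∉t) (y∉t ∷ Ut) with ≤-<-connex (above y t) 1 | <-cmp x y
... | _            | tri≈ _ x≡y _ = ⊥-elim (x≢y x≡y)
... | inj₂ 2≤above | tri< x<y _ _ = begin
  filterᵇ (x <ᵇ_) (exchange (y ∷ t))
    ≡⟨ cong (filterᵇ (x <ᵇ_)) (exchange-keep y t 2≤above) ⟩
  filterᵇ (x <ᵇ_) (y ∷ exchange t)
    ≡⟨ filter-accept (exchange t) x<y ⟩
  y ∷ filterᵇ (x <ᵇ_) (exchange t)
    ≡⟨ cong (y ∷_) (filter-exchange t x∉t Ut) ⟩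
  y ∷ exchange (filterᵇ (x <ᵇ_) t)
    ≡⟨ exchange-keep y (filterᵇ (x <ᵇ_) t) (subst (2 ≤_) (sym (above-filter t x<y)) 2≤above) ⟨
  exchange (y ∷ filterᵇ (x <ᵇ_) t)
    ≡⟨ cong exchange (filter-accept t x<y) ⟨
  exchange (filterᵇ (x <ᵇ_) (y ∷ t)) ∎
  where open ≡-Reasoning
... | inj₂ 2≤above | tri> _ _ y<x = begin
  filterᵇ (x <ᵇ_) (exchange (y ∷ t))
    ≡⟨ cong (filterᵇ (x <ᵇ_)) (exchange-keep y t 2≤above) ⟩
  filterᵇ (x <ᵇ_) (y ∷ exchange t)
    ≡⟨ filter-reject (exchange t) (<⇒≤ y<x) ⟩
  filterᵇ (x <ᵇ_) (exchange t)
    ≡⟨ filter-exchange t x∉t Ut ⟩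
  exchange (filterᵇ (x <ᵇ_) t)
    ≡⟨ cong exchange (filter-reject t (<⇒≤ y<x)) ⟨
  exchange (filterᵇ (x <ᵇ_) (y ∷ t)) ∎
  where open ≡-Reasoning
... | inj₁ above≤1 | tri< x<y _ _ =
  trans (cong (filterᵇ (x <ᵇ_)) (exchange-swap y t above≤1 (maxOf-isMax z s)))
        (filter-exchange-swap-above t x∉t y∉t Ut above≤1 (maxOf-isMax z s) x<y (filter-exchange t x∉t Ut))
... | inj₁ above≤1 | tri> _ _ y<x =
  trans (cong (filterᵇ (x <ᵇ_)) (exchange-swap y t above≤1 (maxOf-isMax z s)))
        (filter-exchange-swap-below t x∉t y∉t Ut above≤1 (maxOf-isMax z s) y<x)

topPairLast-above : ∀ o E u {e} → topPairLast o E u ≡ true → e ∈ E → 2 ≤ above e u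
topPairLast-above o E (a ∷ b ∷ []) {e} tpl e∈E
  with ∧-true⁻ {e <ᵇ a} {e <ᵇ b} (all-∈ {f = below a b} {xs = E} (proj₂ (∧-true⁻ {inOrder o a b} tpl)) e∈E)
... | e<a , e<b with e <ᵇ a | e<a
...   | _ | refl with e <ᵇ b | e<b
...     | _ | refl = ≤-refl
topPairLast-above o E (a ∷ u@(_ ∷ _ ∷ _)) tpl e∈E =
  ≤-trans (topPairLast-above o (E ++ [ a ]) u tpl (∈-++⁺ˡ e∈E)) (above-∷ _ a u)

topPairLast-false : ∀ o E u {e} → e ∈ E → above e u ≤ 1 → topPairLast o E u ≡ false
topPairLast-false o E u e∈E above≤1 with topPairLast o E u in tpl
... | false = refl
... | true  = ⊥-elim (1+n≰n (≤-trans (topPairLast-above o E u tpl e∈E) above≤1))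

topPairLast-short : ∀ o E u → length u ≤ 1 → topPairLast o E u ≡ false
topPairLast-short o E []          _ = refl
topPairLast-short o E (p ∷ [])    _ = refl
topPairLast-short o E (p ∷ q ∷ u) (s≤s ())

topPairLast-step : ∀ o E p u → 2 ≤ length u → topPairLast o E (p ∷ u) ≡ topPairLast o (E ++ [ p ]) u
topPairLast-step o E p (a ∷ b ∷ u) _        = refl
topPairLast-step o E p (a ∷ [])    (s≤s ())

topPairLast-swap : ∀ E p q → topPairLast increasing E (p ∷ q ∷ []) ≡ topPairLast decreasing E (exchange (p ∷ q ∷ []))
topPairLast-swap E p q = begin
  (p <ᵇ q) ∧ all (below p q) E
    ≡⟨ cong ((p <ᵇ q) ∧_) (all-cong (All.universal (λ e → ∧-comm (e <ᵇ p) (e <ᵇ q)) E)) ⟩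
  topPairLast decreasing E (q ∷ p ∷ [])
    ≡⟨ cong (λ b → topPairLast decreasing E (q ∷ (if b then p else q) ∷ [])) (≡ᵇ-refl q) ⟨
  topPairLast decreasing E (q ∷ replace q p (q ∷ []))
    ≡⟨ cong (topPairLast decreasing E) (exchange-swap p (q ∷ []) above≤1 (here refl , ≤-refl ∷ [])) ⟨
  topPairLast decreasing E (exchange (p ∷ q ∷ [])) ∎
  where
    open ≡-Reasoning
    above≤1 : above p (q ∷ []) ≤ 1
    above≤1 = subst (_≤ 1) (sym (count-singleton (p <ᵇ_) q)) (boolToℕ≤1 (p <ᵇ q))

topPairLast-exchange : ∀ E u → Unique u → topPairLast increasing E u ≡ topPairLast decreasing E (exchange u)
topPairLast-exchange E []                         _          = refl
topPairLast-exchange E (p ∷ [])                   _          = refl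
topPairLast-exchange E (p ∷ q ∷ [])               _          = topPairLast-swap E p q
topPairLast-exchange E (p ∷ t@(q ∷ rs@(_ ∷ _))) (p∉t ∷ Ut) with ≤-<-connex (above p t) 1
... | inj₂ 2≤above = begin
  topPairLast increasing (E ++ [ p ]) t
    ≡⟨ topPairLast-exchange (E ++ [ p ]) t Ut ⟩
  topPairLast decreasing (E ++ [ p ]) (exchange t)
    ≡⟨ topPairLast-step decreasing E p (exchange t) (subst (2 ≤_) (sym (exchange-length t)) (s≤s (s≤s z≤n))) ⟨
  topPairLast decreasing E (p ∷ exchange t)
    ≡⟨ cong (topPairLast decreasing E) (exchange-keep p t 2≤above) ⟨
  topPairLast decreasing E (exchange (p ∷ t)) ∎
  where open ≡-Reasoning
... | inj₁ above≤1 = begin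
  topPairLast increasing (E ++ [ p ]) t
    ≡⟨ topPairLast-false increasing (E ++ [ p ]) t (∈-++⁺ʳ E (here refl)) above≤1 ⟩
  false
    ≡⟨ topPairLast-false decreasing (E ++ [ M ]) L (∈-++⁺ʳ E (here refl)) (exchange-top p t Ut isMax) ⟨
  topPairLast decreasing (E ++ [ M ]) L
    ≡⟨ topPairLast-step decreasing E M L 2≤L ⟨
  topPairLast decreasing E (M ∷ L)
    ≡⟨ cong (topPairLast decreasing E) (exchange-swap p t above≤1 isMax) ⟨
  topPairLast decreasing E (exchange (p ∷ t)) ∎
  where
    open ≡-Reasoning
    M : ℕ
    M = maxOf q rs
    isMax : IsMax M t
    isMax = maxOf-isMax q rs
    L : List ℕ
    L = replace M p (exchange t)
    2≤L : 2 ≤ length L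
    2≤L = subst (2 ≤_) (sym (trans (length-map _ (exchange t)) (exchange-length t))) (s≤s (s≤s z≤n))

module _ (f : ℕ → ℕ) (l : List ℕ) (mono : StrictlyMonotoneOn id id f l) where

  inOrder-monotone : ∀ o {a b} → a ∈ l → b ∈ l → inOrder o (f a) (f b) ≡ inOrder o a b
  inOrder-monotone increasing a∈ b∈ = mono a∈ b∈
  inOrder-monotone decreasing a∈ b∈ = mono b∈ a∈

  topPairLast-map : ∀ o E u → (∀ {v} → v ∈ E → v ∈ l) → (∀ {v} → v ∈ u → v ∈ l) →
                    topPairLast o (map f E) (map f u) ≡ topPairLast o E u
  topPairLast-map o E []               _   _   = refl
  topPairLast-map o E (a ∷ [])         _   _   = refl
  topPairLast-map o E (a ∷ b ∷ [])     E⊆l u⊆l =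
    cong₂ _∧_ (inOrder-monotone o a∈ b∈)
              (trans (all-map (below (f a) (f b)) f E)
                     (all-cong (All.tabulate (λ e∈ → cong₂ _∧_ (mono (E⊆l e∈) a∈) (mono (E⊆l e∈) b∈)))))
    where
      a∈ : a ∈ l
      a∈ = u⊆l (here refl)
      b∈ : b ∈ l
      b∈ = u⊆l (there (here refl))
  topPairLast-map o E (a ∷ u@(_ ∷ _ ∷ _)) E⊆l u⊆l =
    trans (cong (λ E′ → topPairLast o E′ (map f u)) (sym (map-++ f E [ a ])))
          (topPairLast-map o (E ++ [ a ]) u (λ v∈ → Sum.[ E⊆l , (λ { (here refl) → u⊆l (here refl) }) ] (∈-++⁻ E v∈))
                                            (u⊆l ∘ there))

  topPairCount-map : ∀ o → topPairCount o (map f l) ≡ topPairCount o l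
  topPairCount-map o = go l id
    where
      go : ∀ t → (∀ {v} → v ∈ t → v ∈ l) → topPairCount o (map f t) ≡ topPairCount o t
      go []      _   = refl
      go (x ∷ t) t⊆l = cong₂ _+_ (cong boolToℕ first) (go t (t⊆l ∘ there))
        where
          first : topPairLast o [] (filterᵇ (f x <ᵇ_) (map f t)) ≡ topPairLast o [] (filterᵇ (x <ᵇ_) t)
          first = begin
            topPairLast o [] (filterᵇ (f x <ᵇ_) (map f t))
              ≡⟨ cong (topPairLast o []) (filter-map (f x <ᵇ_) f t) ⟩
            topPairLast o [] (map f (filterᵇ ((f x <ᵇ_) ∘ f) t))
              ≡⟨ cong (topPairLast o [] ∘ map f)
                      (filter-cong (All.tabulate (λ v∈ → mono (t⊆l (here refl)) (t⊆l (there v∈))))) ⟩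
            topPairLast o [] (map f (filterᵇ (x <ᵇ_) t))
              ≡⟨ topPairLast-map o [] (filterᵇ (x <ᵇ_) t) (λ ())
                                 (λ v∈ → t⊆l (there (proj₁ (∈-filter⁻ (T? ∘ (x <ᵇ_)) v∈)))) ⟩
            topPairLast o [] (filterᵇ (x <ᵇ_) t) ∎
            where open ≡-Reasoning

topPairCount-exchange : ∀ l → Unique l → topPairCount increasing l ≡ topPairCount decreasing (exchange l)
topPairCount-exchange []              _            = refl
topPairCount-exchange (x ∷ [])        _            = refl
topPairCount-exchange (x ∷ t@(y ∷ s)) (x∉t ∷ Ut) with ≤-<-connex (above x t) 1
... | inj₂ 2≤above = begin
  boolToℕ (topPairLast increasing [] (filterᵇ (x <ᵇ_) t)) + topPairCount increasing t
    ≡⟨ cong₂ _+_ (cong boolToℕ first) (topPairCount-exchange t Ut) ⟩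
  boolToℕ (topPairLast decreasing [] (filterᵇ (x <ᵇ_) (exchange t))) + topPairCount decreasing (exchange t)
    ≡⟨ cong (topPairCount decreasing) (exchange-keep x t 2≤above) ⟨
  topPairCount decreasing (exchange (x ∷ t)) ∎
  where
    open ≡-Reasoning
    first : topPairLast increasing [] (filterᵇ (x <ᵇ_) t) ≡ topPairLast decreasing [] (filterᵇ (x <ᵇ_) (exchange t))
    first = trans (topPairLast-exchange [] (filterᵇ (x <ᵇ_) t) (UniqueP.filter⁺ (T? ∘ (x <ᵇ_)) Ut))
                  (cong (topPairLast decreasing []) (sym (filter-exchange t x∉t Ut)))
... | inj₁ above≤1 = begin
  boolToℕ (topPairLast increasing [] (filterᵇ (x <ᵇ_) t)) + topPairCount increasing t
    ≡⟨ cong₂ _+_ (cong boolToℕ (trans (topPairLast-short increasing [] (filterᵇ (x <ᵇ_) t) above≤1)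
                                      (sym (topPairLast-short decreasing [] (filterᵇ (M <ᵇ_) L)
                                                              (exchange-top x t Ut isMax)))))
                 (topPairCount-exchange t Ut) ⟩
  boolToℕ (topPairLast decreasing [] (filterᵇ (M <ᵇ_) L)) + topPairCount decreasing (exchange t)
    ≡⟨ cong (boolToℕ (topPairLast decreasing [] (filterᵇ (M <ᵇ_) L)) +_)
            (topPairCount-map (swapIn M x) (exchange t) (exchange-monotone x∉t above≤1 isMax) decreasing) ⟨
  topPairCount decreasing (M ∷ L)
    ≡⟨ cong (topPairCount decreasing) (exchange-swap x t above≤1 isMax) ⟨
  topPairCount decreasing (exchange (x ∷ t)) ∎
  where
    open ≡-Reasoning
    M : ℕ
    M = maxOf y s
    isMax : IsMax M t
    isMax = maxOf-isMax y s
    L : List ℕ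
    L = replace M x (exchange t)

-- Permutations

module _ {n : ℕ} where

  isPerm⇒injective : (π : Vec (Fin n) n) → isPermᵇ π ≡ true → Injective _≡_ _≡_ (lookup π)
  isPerm⇒injective π perm {i} {j} πi≡πj
    with all-∈ {xs = allFin n} (all-∈ {xs = allFin n} perm (∈-allFin i)) (∈-allFin j)
  ... | distinct rewrite πi≡πj | ≡ᵇ-refl (toℕ (lookup π j)) = toℕ-injective (≡ᵇ-true⁻ distinct)

  injective⇒isPerm : (π : Vec (Fin n) n) → Injective _≡_ _≡_ (lookup π) → isPermᵇ π ≡ true
  injective⇒isPerm π inj = all-intro _ (allFin n) (λ {i} _ → all-intro _ (allFin n) (λ {j} _ → distinct i j))
    where
      distinct : ∀ i j → (not (finEqᵇ (lookup π i) (lookup π j)) ∨ finEqᵇ i j) ≡ true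
      distinct i j with finEqᵇ (lookup π i) (lookup π j) in eq
      ... | false = refl
      ... | true  = trans (cong (λ k → toℕ i ≡ᵇ toℕ k) (sym (inj (toℕ-injective (≡ᵇ-true⁻ eq))))) (≡ᵇ-refl (toℕ i))

module _ {A : Set} where

  lookup-∈ : ∀ {k} (v : Vec A k) i → lookup v i ∈ toList v
  lookup-∈ (x ∷ v) zero    = here refl
  lookup-∈ (x ∷ v) (suc i) = there (lookup-∈ v i)

  ∈-lookup : ∀ {k} (v : Vec A k) {w} → w ∈ toList v → ∃[ i ] lookup v i ≡ w
  ∈-lookup (x ∷ v) (here refl) = zero , refl
  ∈-lookup (x ∷ v) (there w∈)  = Product.map suc id (∈-lookup v w∈)

  Unique⇒injective : ∀ {k} (v : Vec A k) → Unique (toList v) → Injective _≡_ _≡_ (lookup v)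
  Unique⇒injective (x ∷ v) (x∉v ∷ U) {zero}  {zero}  _  = refl
  Unique⇒injective (x ∷ v) (x∉v ∷ U) {zero}  {suc j} eq = ⊥-elim (All.lookup x∉v (lookup-∈ v j) eq)
  Unique⇒injective (x ∷ v) (x∉v ∷ U) {suc i} {zero}  eq = ⊥-elim (All.lookup x∉v (lookup-∈ v i) (sym eq))
  Unique⇒injective (x ∷ v) (x∉v ∷ U) {suc i} {suc j} eq = cong suc (Unique⇒injective v U eq)

  injective⇒Unique : ∀ {k} (v : Vec A k) → Injective _≡_ _≡_ (lookup v) → Unique (toList v)
  injective⇒Unique []      inj = []
  injective⇒Unique (x ∷ v) inj =
    All.tabulate (λ w∈ x≡w → 0≢1+n (inj (trans x≡w (sym (proj₂ (∈-lookup v w∈))))))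
    ∷ injective⇒Unique v (suc-injective ∘ inj)

allVecs-complete : ∀ n k (v : Vec (Fin n) k) → v ∈ allVecs n k
allVecs-complete n zero    []      = here refl
allVecs-complete n (suc k) (x ∷ v) =
  ∈-concat⁺′ (∈-map⁺ (x ∷_) (allVecs-complete n k v)) (∈-map⁺ (λ y → map (y ∷_) (allVecs n k)) (∈-allFin x))

allVecs-unique : ∀ n k → Unique (allVecs n k)
allVecs-unique n zero    = [] ∷ []
allVecs-unique n (suc k) =
  UniqueP.concat⁺ (AllP.map⁺ (All.universal (λ x → UniqueP.map⁺ VecP.∷-injectiveʳ (allVecs-unique n k)) (allFin n)))
                  (AllPairsP.map⁺ (AllPairs.map disjoint (UniqueP.allFin⁺ n)))
  where
    disjoint : ∀ {x y : Fin n} → x ≢ y → Disjoint (map (x ∷_) (allVecs n k)) (map (y ∷_) (allVecs n k))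
    disjoint x≢y (v∈ , v∈′) with ∈-map⁻ (_ ∷_) v∈ | ∈-map⁻ (_ ∷_) v∈′
    ... | _ , _ , refl | _ , _ , eq = x≢y (VecP.∷-injectiveˡ eq)

module _ {n : ℕ} where

  S-isPerm : ∀ {π} → π ∈ S n → isPermᵇ π ≡ true
  S-isPerm π∈ = Equivalence.to T-≡ (proj₂ (∈-filter⁻ (T? ∘ isPermᵇ) {xs = allVecs n n} π∈))

  isPerm-S : ∀ {π} → isPermᵇ π ≡ true → π ∈ S n
  isPerm-S {π} perm = ∈-filter⁺ (T? ∘ isPermᵇ) (allVecs-complete n n π) (Equivalence.from T-≡ perm)

  S-unique : Unique (S n)
  S-unique = UniqueP.filter⁺ (T? ∘ isPermᵇ) (allVecs-unique n n)

  private
    key : Fin n → ℕ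
    key i = suc (toℕ i)

    key-injective : Injective _≡_ _≡_ key
    key-injective = toℕ-injective ∘ ℕP.suc-injective

  module FinExchange = Exchange key

  isPerm⇒Unique : (π : Vec (Fin n) n) → isPermᵇ π ≡ true → Unique (word π)
  isPerm⇒Unique π perm = UniqueP.map⁺ key-injective (injective⇒Unique π (isPerm⇒injective π perm))

  Unique⇒isPerm : (π : Vec (Fin n) n) → Unique (word π) → isPermᵇ π ≡ true
  Unique⇒isPerm π U = injective⇒isPerm π (Unique⇒injective π (UniqueP.map⁻ U))

  word-length : (π : Vec (Fin n) n) → length (word π) ≡ n
  word-length π = trans (length-map key (toList π)) (VecP.length-toList π)

  word-bounded : (π : Vec (Fin n) n) → All (_< suc n) (word π)
  word-bounded π = AllP.map⁺ (All.universal (λ i → s≤s (toℕ<n i)) (toList π))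

  word-injective : {π π′ : Vec (Fin n) n} → word π ≡ word π′ → π ≡ π′
  word-injective {π} {π′} eq =
    trans (sym (cast-is-id refl π)) (VecP.toList-injective refl π π′ (map-injective key-injective eq))

  exchangeᵛ : Vec (Fin n) n → Vec (Fin n) n
  exchangeᵛ π = Vec.cast (trans (FinExchange.exchange-length (toList π)) (VecP.length-toList π))
                         (Vec.fromList (FinExchange.exchange (toList π)))

  word-exchangeᵛ : (π : Vec (Fin n) n) → word (exchangeᵛ π) ≡ exchange (word π)
  word-exchangeᵛ π =
    trans (cong (map key) (trans (VecP.toList-cast _ _) (VecP.toList∘fromList _)))
          (sym (exchange-map key id key (toList π) (λ _ _ → refl)))

  exchangeᵛ-isPerm : (π : Vec (Fin n) n) → isPermᵇ π ≡ true → isPermᵇ (exchangeᵛ π) ≡ true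
  exchangeᵛ-isPerm π perm =
    Unique⇒isPerm (exchangeᵛ π)
      (subst Unique (sym (word-exchangeᵛ π)) (Unique-exchange (word π) (isPerm⇒Unique π perm)))

  exchangeᵛ-involutive : (π : Vec (Fin n) n) → isPermᵇ π ≡ true → exchangeᵛ (exchangeᵛ π) ≡ π
  exchangeᵛ-involutive π perm = word-injective (begin
    word (exchangeᵛ (exchangeᵛ π))   ≡⟨ word-exchangeᵛ (exchangeᵛ π) ⟩
    exchange (word (exchangeᵛ π))    ≡⟨ cong exchange (word-exchangeᵛ π) ⟩
    exchange (exchange (word π))     ≡⟨ exchange-involutive (word π) (isPerm⇒Unique π perm) ⟩
    word π                           ∎)
    where open ≡-Reasoning

  exchangeᵛ-permutes-S : map exchangeᵛ (S n) ↭ S n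
  exchangeᵛ-permutes-S =
    map-involution-↭ exchangeᵛ S-unique (λ {π} π∈ → isPerm-S (exchangeᵛ-isPerm π (S-isPerm π∈)))
                                         (λ {π} π∈ → exchangeᵛ-involutive π (S-isPerm π∈))

  occurrences-topPairCount : ∀ o σ → (∀ x y z → orderIsoᵇ (x ∷ y ∷ z ∷ []) σ ≡ topPairOrder o x y z) →
    (π : Vec (Fin n) n) → isPermᵇ π ≡ true →
    length (filterᵇ (isOccurrenceᵇ (mesh σ R₄₆) n (word π)) (choose 3 (positions n))) ≡ topPairCount o (word π)
  occurrences-topPairCount o σ orderIso-≡ π perm = begin
    length (filterᵇ (isOccurrenceᵇ (mesh σ R₄₆) n (word π)) (choose 3 (positions n)))
      ≡⟨ occurrences-as-triples σ n (word π) (word-length π) ⟩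
    TripleCount.triples (Shading₄₆.test σ (suc n)) (word π)
      ≡⟨ triples-cong (agree-topPair o σ (suc n) orderIso-≡) (word π) (isPerm⇒Unique π perm) (word-bounded π) ⟩
    TripleCount.triples (topPairTest o) (word π)
      ≡⟨ TopPair.triples-topPair o (word π) ⟩
    topPairCount o (word π) ∎
    where open ≡-Reasoning

  occurrences-exchangeᵛ : ∀ {π} → π ∈ S n → occurrences p123 π ≡ occurrences p132 (exchangeᵛ π)
  occurrences-exchangeᵛ {π} π∈S = begin
    occurrences p123 π
      ≡⟨ occurrences-topPairCount increasing (1 ∷ 2 ∷ 3 ∷ []) orderIso-123 π perm ⟩
    topPairCount increasing (word π)
      ≡⟨ topPairCount-exchange (word π) (isPerm⇒Unique π perm) ⟩
    topPairCount decreasing (exchange (word π))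
      ≡⟨ cong (topPairCount decreasing) (word-exchangeᵛ π) ⟨
    topPairCount decreasing (word (exchangeᵛ π))
      ≡⟨ occurrences-topPairCount decreasing (1 ∷ 3 ∷ 2 ∷ []) orderIso-132 (exchangeᵛ π) (exchangeᵛ-isPerm π perm) ⟨
    occurrences p132 (exchangeᵛ π) ∎
    where
      open ≡-Reasoning
      perm : isPermᵇ π ≡ true
      perm = S-isPerm π∈S

theorem4p6 : p123 ∼d p132
theorem4p6 n ℓ = begin
  length (filterᵇ (λ π → occurrences p123 π ≡ᵇ ℓ) (S n))
    ≡⟨ count-cong (All.tabulate (λ π∈ → cong (_≡ᵇ ℓ) (occurrences-exchangeᵛ {n} π∈))) ⟩
  length (filterᵇ (λ π → occurrences p132 (exchangeᵛ π) ≡ᵇ ℓ) (S n))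
    ≡⟨ count-map (λ π → occurrences p132 π ≡ᵇ ℓ) exchangeᵛ (S n) ⟨
  length (filterᵇ (λ π → occurrences p132 π ≡ᵇ ℓ) (map exchangeᵛ (S n)))
    ≡⟨ count-↭ (λ π → occurrences p132 π ≡ᵇ ℓ) (exchangeᵛ-permutes-S {n}) ⟩
  length (filterᵇ (λ π → occurrences p132 π ≡ᵇ ℓ) (S n)) ∎
  where open ≡-Reasoning
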